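{- (i) For $\alpha\ge 2$, the vector of length $\alpha$ consisting of a $1$ followed by $\alpha-1$ entries equal to $2$, i.e. $(1,2,\ldots,2)$, is realized by exactly one graph up to isomorphism, namely the path $P_{2\alpha-1}$. (ii) No vector of the form $(1,2,\ldots,2,1)$ (a $1$, then one or more $2$'s, then a $1$) is realizable. (iii) For $\alpha\ge1$, the vector $(2,\ldots,2)$ of length $\alpha$ is 0-realized by exactly one graph up to isomorphism, namely the path $P_{2\alpha}$. (iv) No vector of the form $(2,\ldots,2,1)$ (one or more $2$'s followed by a $1$) is 0-realizable.
   Context: All graphs are finite, nonempty, simple and reflexive (each vertex adjacent to itself). $P_m$ is the path on $m$ vertices. Corner ranking: $N[v]$ is the closed neighborhood. In a graph $H$, $w$ strictly corners a distinct vertex $v$ if $N[v]\subsetneq N[w]$. Set $G^{(1)}=G$, $k=1$. If $G^{(k)}$ is a clique, give its vertices rank $k$ and stop; else if it has no strict corners, give its vertices rank $\infty$ and stop; else give all strict corners of $G^{(k)}$ rank $k$, delete them to get $G^{(k+1)}$, increase $k$, repeat. The corner rank $\alpha$ is the largest vertex rank; a graph is cop-win (in the game of cops and robbers with one cop) iff its corner rank is finite. $G$ is of type 1 if some (equivalently every) vertex of rank $\alpha$ is adjacent to all vertices of $G^{(\alpha-1)}$, type 0 otherwise. The rank cardinality vector of $G$ is $(x_\alpha,\ldots,x_1)$ with $x_k$ the number of vertices of rank $k$. A vector of positive integers is realizable (resp. 0-realizable) if it is the rank cardinality vector of some cop-win graph (resp. cop-win graph of type 0); such a graph realizes (resp.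 0-realizes) it. -}

module Defs where

open import Data.Nat using (ℕ; zero; suc; _≤_; _<_; _∸_; _⊔_; _≤ᵇ_; _≡ᵇ_; s≤s; z≤n)
open import Data.Nat.Properties using (≤⇒≤ᵇ; n≤1+n)
open import Data.Bool using (Bool; true; false; _∧_; _∨_; not; if_then_else_)
open import Data.Bool.Properties using (∧-comm)
open import Data.Fin using (Fin; zero; suc; toℕ)
open import Data.List using (List; []; _∷_; map; downFrom)
open import Data.Maybe using (Maybe; just; nothing)
open import Data.Product using (Σ; _×_; _,_)
open import Relation.Binary.PropositionalEquality using (_≡_; _≢_; refl)
open import Relation.Nullary using (¬_)
open import Function using (_∘_)

record Graph : Set where
  field
    order    : ℕ
    nonempty : 1 ≤ order
    adj      : Fin order → Fin order → Bool
    adj-refl : ∀ v → adj v v ≡ true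
    adj-sym  : ∀ u v → adj u v ≡ adj v u
open Graph public

allB : ∀ {n} → (Fin n → Bool) → Bool
allB {zero}  f = true
allB {suc n} f = f zero ∧ allB (f ∘ suc)

anyB : ∀ {n} → (Fin n → Bool) → Bool
anyB {zero}  f = false
anyB {suc n} f = f zero ∨ anyB (f ∘ suc)

countB : ∀ {n} → (Fin n → Bool) → ℕ
countB {zero}  f = 0
countB {suc n} f = (if f zero then 1 else 0) Data.Nat.+ countB (f ∘ suc)

maxF : ∀ {n} → (Fin n → ℕ) → ℕ
maxF {zero}  f = 0
maxF {suc n} f = f zero ⊔ maxF (f ∘ suc)

-- Corner ranking.  A vertex subset S (Fin n → Bool) describes the
-- induced subgraph G^(k).

module _ (G : Graph) where
  private
    n = order G
    Sub = Fin n → Bool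

  allV : Sub
  allV _ = true

  inN : Sub → Fin n → Fin n → Bool
  inN S v u = S u ∧ adj G v u

  subN : Sub → Fin n → Fin n → Bool
  subN S v w = allB λ u → not (inN S v u) ∨ inN S w u

  strictCorner : Sub → Fin n → Bool
  strictCorner S v = S v ∧ anyB λ w →
    S w ∧ not (toℕ v ≡ᵇ toℕ w) ∧ subN S v w ∧ not (subN S w v)

  isClique : Sub → Bool
  isClique S = allB λ u → allB λ v → not (S u ∧ S v) ∨ adj G u v

  hasCorner : Sub → Bool
  hasCorner S = anyB (strictCorner S)

  step : Sub → Sub
  step S u = S u ∧ not (strictCorner S u)

  -- G^(k) for k ≥ 1 (G^(1) = G)
  stage : ℕ → Sub
  stage zero    = allV
  stage (suc zero) = allV
  stage (suc (suc k)) = step (stage (suc k))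

  -- rank; nothing represents ∞.  The fuel (order of G) is never exhausted
  -- since each non-final round deletes at least one vertex.
  rankAux : ℕ → ℕ → Sub → Fin n → Maybe ℕ
  rankAux zero     k S v = nothing
  rankAux (suc f)  k S v =
    if isClique S then just k
    else if not (hasCorner S) then nothing
    else if strictCorner S v then just k
    else rankAux f (suc k) (step S) v

  rank : Fin n → Maybe ℕ
  rank v = rankAux n 1 allV v

  rankℕ : Fin n → ℕ
  rankℕ v with rank v
  ... | just k  = k
  ... | nothing = 0

  CopWin : Set
  CopWin = ∀ v → rank v ≢ nothing

  -- corner rank α (meaningful for cop-win graphs)
  cornerRank : ℕ
  cornerRank = maxF rankℕ

  hasRank : ℕ → Fin n → Bool
  hasRank k v with rank v
  ... | just m  = m ≡ᵇ k
  ... | nothing = false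

  -- rank cardinality vector (x_α, …, x_1)
  rankCardVec : List ℕ
  rankCardVec = map (λ k → countB (hasRank k)) (map suc (downFrom cornerRank))

  -- type 1: some vertex of rank α is adjacent to all vertices of G^(α-1)
  -- (convention: α ≥ 2 is required; cliques, α = 1, are of type 0)
  Type1 : Set
  Type1 = (2 ≤ cornerRank) × Σ (Fin n) λ v → rank v ≡ just cornerRank ×
            (∀ u → stage (cornerRank ∸ 1) u ≡ true → adj G v u ≡ true)

  Type0 : Set
  Type0 = ¬ Type1

Realizes : Graph → List ℕ → Set
Realizes G xs = CopWin G × rankCardVec G ≡ xs

Realizes0 : Graph → List ℕ → Set
Realizes0 G xs = Realizes G xs × Type0 G

Realizable : List ℕ → Set
Realizable xs = Σ Graph λ G → Realizes G xs

Realizable0 : List ℕ → Set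
Realizable0 xs = Σ Graph λ G → Realizes0 G xs

record _≅_ (G H : Graph) : Set where
  field
    to      : Fin (order G) → Fin (order H)
    from    : Fin (order H) → Fin (order G)
    from-to : ∀ v → from (to v) ≡ v
    to-from : ∀ w → to (from w) ≡ w
    adj-pres : ∀ u v → adj H (to u) (to v) ≡ adj G u v

pathAdj : ∀ {m} → Fin m → Fin m → Bool
pathAdj i j = (toℕ i ≤ᵇ suc (toℕ j)) ∧ (toℕ j ≤ᵇ suc (toℕ i))

P : (m : ℕ) → 1 ≤ m → Graph
P m m≥1 = record
  { order = m ; nonempty = m≥1 ; adj = pathAdj
  ; adj-refl = λ v → refl-lem (toℕ v)
  ; adj-sym = λ u v → ∧-comm (toℕ u ≤ᵇ suc (toℕ v)) _ }
  where
    refl-lem : ∀ k → ((k ≤ᵇ suc k) ∧ (k ≤ᵇ suc k)) ≡ true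
    refl-lem k with ≤⇒≤ᵇ (n≤1+n k)
    ... | t with k ≤ᵇ suc k
    ... | true = refl

open import Data.Nat using (_*_; _+_)
open import Data.Nat.Properties using (≤-trans; m≤m+n; +-suc)

ne-odd : ∀ {α} → 2 ≤ α → 1 ≤ 2 * α ∸ 1
ne-odd {suc zero} (s≤s ())
ne-odd {suc (suc a)} _ rewrite +-suc a (suc (a + 0)) = s≤s z≤n

ne-even : ∀ {α} → 1 ≤ α → 1 ≤ 2 * α
ne-even {suc a} _ = s≤s z≤n

module Submission where

-- Everything rests on two converse facts about a round S and its successor T (S minus
-- its strict corners):
--   peeling:   if S induces a path on ≥ 3 vertices, its corners are its two ends and T
--              is the inner path (PathEnds); paths on ≤ 2 vertices are cliques;
--   unpeeling: if T induces a path and the corners of S are among x, y, then a corner is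
--              attached to each end of T, since otherwise that end would itself be a
--              corner of S; two corners therefore extend T to a path with two more
--              vertices, and one corner is impossible (Unpeel).
-- Peeling computes the rank counts of P_m (path-ranks): existence in (i) and (iii).
-- Unpeeling by induction from the top round down (Reconstruction) shows that the counts
-- (1,2,…,2) and, under type 0, (2,…,2) make every round a path, whence uniqueness via a
-- spanning path, while (1,2,…,2,1) and (2,…,2,1) would glue a single corner: (ii), (iv).

open import Defs
open import Data.Nat using (ℕ; zero; suc; _≤_; _<_; _∸_; _+_; _*_; s≤s; z≤n; _≤ᵇ_; _≡ᵇ_)
open import Data.Nat.Properties
  using (≤-refl; ≤-trans; ≤-antisym; ≤-pred; <-irrefl; n≤1+n; suc-injective; ≤-total; <-cmp;
         m≤n⇒m<n∨m≡n; +-suc; +-identityʳ; +-comm; m≤m+n; m≤n+m; +-monoʳ-≤; m<m+n;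
         m≤m⊔n; m≤n⊔m; ⊔-lub; ≤ᵇ⇒≤; ≤⇒≤ᵇ; 0≢1+n; 1+n≢0; n≮0)
open import Data.Bool using (Bool; true; false; _∧_; _∨_; not; if_then_else_)
open import Data.Bool.Properties using (∧-comm; T-≡; ∧-conicalˡ; ∧-conicalʳ; ∧-zeroʳ; ∧-identityʳ; not-injective; ¬-not)
open import Data.Fin using (Fin; zero; suc; toℕ; fromℕ<)
open import Data.Fin.Properties using (toℕ-injective; toℕ-fromℕ<; toℕ<n)
  renaming (suc-injective to fsuc-injective; 0≢1+n to zero≢suc)
open import Data.Maybe using (Maybe; just; nothing)
open import Data.List using (List; []; _∷_; map; downFrom; replicate; _++_; length)
open import Data.List.Properties using (∷-injective; map-cong; length-map; length-downFrom; length-replicate)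
open import Data.Product using (Σ; _×_; _,_; proj₁; proj₂)
open import Data.Sum using (_⊎_; inj₁; inj₂; [_,_]; swap) renaming (map to ⊎-map; map₂ to ⊎-map₂)
open import Data.Empty using (⊥; ⊥-elim)
open import Relation.Nullary using (¬_)
open import Relation.Binary using (tri<; tri≈; tri>)
open import Relation.Binary.PropositionalEquality using (_≡_; _≢_; refl; sym; trans; cong; cong₂; subst)
open import Function using (_∘_)
open import Function.Bundles using (Equivalence)

∧-intro : ∀ {a b} → a ≡ true → b ≡ true → a ∧ b ≡ true
∧-intro refl refl = refl

clash : ∀ {b} → b ≡ true → b ≡ false → ⊥
clash refl ()

false-if-not-true : ∀ {b} → b ≢ true → b ≡ false
false-if-not-true = ¬-not

false-if-not : ∀ {b} → not b ≡ true → b ≡ false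
false-if-not = not-injective

allB-sound : ∀ {n} (f : Fin n → Bool) → allB f ≡ true → ∀ i → f i ≡ true
allB-sound f p zero    = ∧-conicalˡ _ _ p
allB-sound f p (suc i) = allB-sound (f ∘ suc) (∧-conicalʳ _ _ p) i

allB-complete : ∀ {n} (f : Fin n → Bool) → (∀ i → f i ≡ true) → allB f ≡ true
allB-complete {zero}  f p = refl
allB-complete {suc n} f p = ∧-intro (p zero) (allB-complete (f ∘ suc) (p ∘ suc))

allB-false : ∀ {n} (f : Fin n → Bool) → allB f ≡ false → Σ (Fin n) λ i → f i ≡ false
allB-false {suc n} f p with f zero in eq
... | false = zero , eq
... | true  = let (i , q) = allB-false (f ∘ suc) p in suc i , q

anyB-sound : ∀ {n} (f : Fin n → Bool) → anyB f ≡ true → Σ (Fin n) λ i → f i ≡ true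
anyB-sound {suc n} f p with f zero in eq
... | true  = zero , eq
... | false = let (i , q) = anyB-sound (f ∘ suc) p in suc i , q

anyB-complete : ∀ {n} (f : Fin n → Bool) i → f i ≡ true → anyB f ≡ true
anyB-complete f zero    p rewrite p = refl
anyB-complete f (suc i) p with f zero
... | true  = refl
... | false = anyB-complete (f ∘ suc) i p

countB-cong : ∀ {n} (f g : Fin n → Bool) → (∀ i → f i ≡ g i) → countB f ≡ countB g
countB-cong {zero}  f g p = refl
countB-cong {suc n} f g p rewrite p zero = cong (_ +_) (countB-cong (f ∘ suc) (g ∘ suc) (p ∘ suc))

countB-none : ∀ {n} (f : Fin n → Bool) → (∀ i → f i ≡ false) → countB f ≡ 0
countB-none {zero}  f p = refl
countB-none {suc n} f p rewrite p zero = countB-none (f ∘ suc) (p ∘ suc)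

countB-witness : ∀ {n} (f : Fin n → Bool) {c} → countB f ≡ suc c → Σ (Fin n) λ i → f i ≡ true
countB-witness {suc n} f p with f zero in eq
... | true  = zero , eq
... | false = let (i , q) = countB-witness (f ∘ suc) p in suc i , q

Only : ∀ {n} → (Fin n → Bool) → Fin n → Set
Only f a = ∀ i → f i ≡ true → i ≡ a

Only2 : ∀ {n} → (Fin n → Bool) → Fin n → Fin n → Set
Only2 f a b = ∀ i → f i ≡ true → i ≡ a ⊎ i ≡ b

countB-zero-inv : ∀ {n} (f : Fin n → Bool) → countB f ≡ 0 → ∀ i → f i ≡ true → ⊥
countB-zero-inv f p zero q rewrite q with p
... | ()
countB-zero-inv f p (suc i) q with f zero
... | false = countB-zero-inv (f ∘ suc) p i q

countB-one : ∀ {n} (f : Fin n → Bool) a → f a ≡ true → Only f a → countB f ≡ 1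
countB-one f zero fa only rewrite fa =
  cong suc (countB-none (f ∘ suc) λ i → false-if-not-true λ q → zero≢suc (sym (only (suc i) q)))
countB-one f (suc a) fa only with f zero in eq
... | true  = ⊥-elim (zero≢suc (only zero eq))
... | false = countB-one (f ∘ suc) a fa λ i q → fsuc-injective (only (suc i) q)

countB-two : ∀ {n} (f : Fin n → Bool) a b → a ≢ b → f a ≡ true → f b ≡ true → Only2 f a b → countB f ≡ 2
countB-two f zero zero a≢b _ _ _ = ⊥-elim (a≢b refl)
countB-two f zero (suc b) _ fa fb only rewrite fa =
  cong suc (countB-one (f ∘ suc) b fb λ i q → [ (λ e → ⊥-elim (zero≢suc (sym e))) , fsuc-injective ] (only (suc i) q))
countB-two f (suc a) zero _ fa fb only rewrite fb =
  cong suc (countB-one (f ∘ suc) a fa λ i q → [ fsuc-injective , (λ e → ⊥-elim (zero≢suc (sym e))) ] (only (suc i) q))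
countB-two f (suc a) (suc b) a≢b fa fb only with f zero in eq
... | true  = ⊥-elim ([ zero≢suc , zero≢suc ] (only zero eq))
... | false = countB-two (f ∘ suc) a b (a≢b ∘ cong suc) fa fb
                λ i q → ⊎-map fsuc-injective fsuc-injective (only (suc i) q)

countB-one-inv : ∀ {n} (f : Fin n → Bool) → countB f ≡ 1 → Σ (Fin n) λ a → f a ≡ true × Only f a
countB-one-inv {suc n} f p with f zero in eq
... | true  = zero , eq , λ { zero _ → refl
                            ; (suc i) q → ⊥-elim (countB-zero-inv (f ∘ suc) (suc-injective p) i q) }
... | false = let (a , fa , only) = countB-one-inv (f ∘ suc) p in
  suc a , fa , λ { zero q → ⊥-elim (clash q eq) ; (suc i) q → cong suc (only i q) }

countB-two-inv : ∀ {n} (f : Fin n → Bool) → countB f ≡ 2 →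
  Σ (Fin n) λ a → Σ (Fin n) λ b → a ≢ b × f a ≡ true × f b ≡ true × Only2 f a b
countB-two-inv {suc n} f p with f zero in eq
... | true  = let (b , fb , only) = countB-one-inv (f ∘ suc) (suc-injective p) in
  zero , suc b , zero≢suc , eq , fb , λ { zero _ → inj₁ refl ; (suc i) q → inj₂ (cong suc (only i q)) }
... | false = let (a , b , a≢b , fa , fb , only) = countB-two-inv (f ∘ suc) p in
  suc a , suc b , a≢b ∘ fsuc-injective , fa , fb ,
  λ { zero q → ⊥-elim (clash q eq) ; (suc i) q → ⊎-map (cong suc) (cong suc) (only i q) }

≡ᵇ-refl : ∀ m → (m ≡ᵇ m) ≡ true
≡ᵇ-refl zero    = refl
≡ᵇ-refl (suc m) = ≡ᵇ-refl m

≡ᵇ-sound : ∀ m k → (m ≡ᵇ k) ≡ true → m ≡ k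
≡ᵇ-sound zero    zero    p = refl
≡ᵇ-sound (suc m) (suc k) p = cong suc (≡ᵇ-sound m k p)

≡ᵇ-false : ∀ m k → m ≢ k → (m ≡ᵇ k) ≡ false
≡ᵇ-false m k m≢k = false-if-not-true λ p → m≢k (≡ᵇ-sound m k p)

padj : ℕ → ℕ → Bool
padj i j = (i ≤ᵇ suc j) ∧ (j ≤ᵇ suc i)

≤ᵇ-complete : ∀ {m n} → m ≤ n → (m ≤ᵇ n) ≡ true
≤ᵇ-complete p = Equivalence.to T-≡ (≤⇒≤ᵇ p)

≤ᵇ-sound : ∀ m n → (m ≤ᵇ n) ≡ true → m ≤ n
≤ᵇ-sound m n p = ≤ᵇ⇒≤ m n (Equivalence.from T-≡ p)

padj-sound : ∀ i j → padj i j ≡ true → i ≤ suc j × j ≤ suc i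
padj-sound i j p = ≤ᵇ-sound i (suc j) (∧-conicalˡ _ _ p) , ≤ᵇ-sound j (suc i) (∧-conicalʳ (i ≤ᵇ suc j) _ p)

padj-complete : ∀ i j → i ≤ suc j → j ≤ suc i → padj i j ≡ true
padj-complete i j p q = ∧-intro (≤ᵇ-complete p) (≤ᵇ-complete q)

padj-far : ∀ i j → suc (suc i) ≤ j → padj i j ≡ false
padj-far i j p = false-if-not-true λ q → <-irrefl refl (≤-trans p (proj₂ (padj-sound i j q)))

padj-sym : ∀ i j → padj i j ≡ padj j i
padj-sym i j = ∧-comm (i ≤ᵇ suc j) (j ≤ᵇ suc i)

suc-≤ᵇ-suc : ∀ a b → (suc a ≤ᵇ suc b) ≡ (a ≤ᵇ b)
suc-≤ᵇ-suc zero    b = refl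
suc-≤ᵇ-suc (suc a) b = refl

padj-suc : ∀ i j → padj (suc i) (suc j) ≡ padj i j
padj-suc i j = cong₂ _∧_ (suc-≤ᵇ-suc i (suc j)) (suc-≤ᵇ-suc j (suc i))

padj-refl : ∀ i → padj i i ≡ true
padj-refl i = padj-complete i i (n≤1+n i) (n≤1+n i)

padj-next : ∀ i → padj i (suc i) ≡ true
padj-next i = padj-complete i (suc i) (≤-trans (n≤1+n i) (n≤1+n (suc i))) ≤-refl

padj-prev : ∀ i → padj (suc i) i ≡ true
padj-prev i = trans (padj-sym (suc i) i) (padj-next i)

below2 : ∀ i → i < 2 → i ≡ 0 ⊎ i ≡ 1
below2 zero          _ = inj₁ refl
below2 (suc zero)    _ = inj₂ refl
below2 (suc (suc i)) (s≤s (s≤s ()))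

-- Length arithmetic: each round of peeling removes two vertices of a path.

double-suc : ∀ d → suc d + suc d ≡ suc (suc (d + d))
double-suc d = cong suc (+-suc d d)

peel-length : ∀ r d → r + (suc d + suc d) ≡ suc (suc (r + (d + d)))
peel-length r d = trans (cong (r +_) (double-suc d)) (trans (+-suc r _) (cong suc (+-suc r (d + d))))

maxF-upper : ∀ {n} (g : Fin n → ℕ) v → g v ≤ maxF g
maxF-upper g zero    = m≤m⊔n _ _
maxF-upper g (suc v) = ≤-trans (maxF-upper (g ∘ suc) v) (m≤n⊔m (g zero) _)

maxF-least : ∀ {n} (g : Fin n → ℕ) c → (∀ v → g v ≤ c) → maxF g ≤ c
maxF-least {zero}  g c h = z≤n
maxF-least {suc n} g c h = ⊔-lub (h zero) (maxF-least (g ∘ suc) c (h ∘ suc))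

-- Entries of a count vector  map g (map suc (downFrom a)) = (g a, …, g 1).

replicate-entries : ∀ a c (g : ℕ → ℕ) → map g (map suc (downFrom a)) ≡ replicate a c → ∀ j → 1 ≤ j → j ≤ a → g j ≡ c
replicate-entries zero    c g e (suc j) _ ()
replicate-entries (suc a) c g e j 1≤j j≤ with m≤n⇒m<n∨m≡n j≤ | ∷-injective e
... | inj₂ refl   | top , _    = top
... | inj₁ j<1+a  | _   , rest = replicate-entries a c g rest j 1≤j (≤-pred j<1+a)

entries-replicate : ∀ a c (g : ℕ → ℕ) → (∀ j → 1 ≤ j → j ≤ a → g j ≡ c) → map g (map suc (downFrom a)) ≡ replicate a c
entries-replicate zero    c g h = refl
entries-replicate (suc a) c g h =
  cong₂ _∷_ (h (suc a) (s≤s z≤n) ≤-refl) (entries-replicate a c g λ j 1≤j j≤a → h j 1≤j (≤-trans j≤a (n≤1+n a)))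

snoc-entries : ∀ a c e (g : ℕ → ℕ) → map g (map suc (downFrom (suc a))) ≡ replicate a c ++ e ∷ [] →
  g 1 ≡ e × (∀ j → 2 ≤ j → j ≤ suc a → g j ≡ c)
snoc-entries zero    c e g eq = proj₁ (∷-injective eq) , λ { (suc zero) (s≤s ()) _ ; (suc (suc j)) _ (s≤s ()) }
snoc-entries (suc a) c e g eq with ∷-injective eq
... | top , rest = proj₁ (snoc-entries a c e g rest) , entry
  where
  entry : ∀ j → 2 ≤ j → j ≤ suc (suc a) → g j ≡ c
  entry j 2≤j j≤ with m≤n⇒m<n∨m≡n j≤
  ... | inj₂ refl = top
  ... | inj₁ j<   = proj₂ (snoc-entries a c e g rest) j 2≤j (≤-pred j<)

length-snoc : ∀ a (c e : ℕ) → length (replicate a c ++ e ∷ []) ≡ suc a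
length-snoc zero    c e = refl
length-snoc (suc a) c e = cong suc (length-snoc a c e)

module OnGraph (G : Graph) where

  Vertex : Set
  Vertex = Fin (order G)

  VSet : Set
  VSet = Vertex → Bool

  A : Vertex → Vertex → Bool
  A = adj G

  A-sym : ∀ u v → A u v ≡ true → A v u ≡ true
  A-sym u v p = trans (adj-sym G v u) p

  Dominated : VSet → Vertex → Vertex → Set
  Dominated S v w = ∀ u → S u ≡ true → A v u ≡ true → A w u ≡ true

  dominated-trans : ∀ {S a b c} → Dominated S a b → Dominated S b c → Dominated S a c
  dominated-trans ab bc u su au = bc u su (ab u su au)

  dominator-adj : ∀ {S z w} → S z ≡ true → Dominated S z w → A w z ≡ true
  dominator-adj {z = z} sz z⊑w = z⊑w z sz (adj-refl G z)

  subN-sound : ∀ S v w → subN G S v w ≡ true → Dominated S v w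
  subN-sound S v w p u su avu with allB-sound _ p u
  ... | q rewrite su | avu = q

  subN-complete : ∀ S v w → Dominated S v w → subN G S v w ≡ true
  subN-complete S v w v⊑w = allB-complete _ λ u → pointwise u (S u) refl (A v u) refl
    where
    pointwise : ∀ u b → S u ≡ b → ∀ c → A v u ≡ c → (not (b ∧ c) ∨ (S u ∧ A w u)) ≡ true
    pointwise u false _  c     _   = refl
    pointwise u true  _  false _   = refl
    pointwise u true  su true  avu rewrite su | v⊑w u su avu = refl

  subN-false : ∀ S v w → subN G S v w ≡ false →
    Σ Vertex λ u → S u ≡ true × A v u ≡ true × A w u ≡ false
  subN-false S v w p with allB-false _ p
  ... | u , q with S u in su | A v u in avu | A w u in awu
  ... | true  | true  | false = u , su , avu , awu
  ... | true  | true  | true  = ⊥-elim (clash refl q)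
  ... | true  | false | _     = ⊥-elim (clash refl q)
  ... | false | _     | _     = ⊥-elim (clash refl q)

  record Cornered (S : VSet) (v : Vertex) : Set where
    constructor cornered
    field
      w    : Vertex
      w∈S  : S w ≡ true
      v≢w  : v ≢ w
      v⊑w  : Dominated S v w
      u    : Vertex
      u∈S  : S u ≡ true
      wu   : A w u ≡ true
      ¬vu  : A v u ≡ false

  corner-sound : ∀ S v → strictCorner G S v ≡ true → Cornered S v
  corner-sound S v p with anyB-sound _ (∧-conicalʳ (S v) _ p)
  ... | w , q with S w in w∈S | toℕ v ≡ᵇ toℕ w in v≡w | subN G S v w in v⊑w | subN G S w v in w⊑v
  ... | true | false | true | false =
    let (u , u∈S , wu , ¬vu) = subN-false S w v w⊑v in
    cornered w w∈S v≢w (subN-sound S v w v⊑w) u u∈S wu ¬vu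
    where
    v≢w : v ≢ w
    v≢w refl = clash (≡ᵇ-refl (toℕ v)) v≡w
  ... | false | _    | _     | _    = ⊥-elim (clash q refl)
  ... | true  | true | _     | _    = ⊥-elim (clash q refl)
  ... | true  | false | false | _   = ⊥-elim (clash q refl)
  ... | true  | false | true  | true = ⊥-elim (clash q refl)

  corner-complete : ∀ S v w u → S v ≡ true → S w ≡ true → v ≢ w → Dominated S v w →
    S u ≡ true → A w u ≡ true → A v u ≡ false → strictCorner G S v ≡ true
  corner-complete S v w u sv sw v≢w v⊑w su awu avu rewrite sv =
    anyB-complete _ w (∧-intro sw (∧-intro (cong not (≡ᵇ-false _ _ (v≢w ∘ toℕ-injective)))
      (∧-intro (subN-complete S v w v⊑w) (cong not w⋢v))))
    where
    w⋢v : subN G S w v ≡ false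
    w⋢v = false-if-not-true λ q → clash (subN-sound S w v q u su awu) avu

  corner∈S : ∀ S v → strictCorner G S v ≡ true → S v ≡ true
  corner∈S S v = ∧-conicalˡ _ _

  Full : VSet → Vertex → Set
  Full S t = ∀ u → S u ≡ true → A t u ≡ true

  full-not-corner : ∀ S t → Full S t → strictCorner G S t ≡ true → ⊥
  full-not-corner S t full c = let open Cornered (corner-sound S t c) in clash (full u u∈S) ¬vu

  clique-sound : ∀ S → isClique G S ≡ true → ∀ u v → S u ≡ true → S v ≡ true → A u v ≡ true
  clique-sound S p u v su sv with allB-sound _ (allB-sound _ p u) v
  ... | q rewrite su | sv = q

  clique-complete : ∀ S → (∀ u v → S u ≡ true → S v ≡ true → A u v ≡ true) → isClique G S ≡ true
  clique-complete S h = allB-complete _ λ u → allB-complete _ λ v → pointwise u v (S u) refl (S v) refl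
    where
    pointwise : ∀ u v b → S u ≡ b → ∀ c → S v ≡ c → (not (b ∧ c) ∨ A u v) ≡ true
    pointwise u v false _  _     _  = refl
    pointwise u v true  _  false _  = refl
    pointwise u v true  su true  sv = h u v su sv

  -- Two vertices cannot be strict corners of a subgraph containing nothing else:
  -- the dominator of each would have to be the other, making N[x] = N[y].
  not-all-corners : ∀ S x y → (∀ u → S u ≡ true → u ≡ x ⊎ u ≡ y) →
    strictCorner G S x ≡ true → strictCorner G S y ≡ true → ⊥
  not-all-corners S x y only cx cy with corner-sound S x cx
  ... | cornered w w∈S x≢w x⊑w u u∈S wu ¬xu with only w w∈S
  ... | inj₁ w≡x = x≢w (sym w≡x)
  ... | inj₂ refl with corner-sound S w cy
  ... | cornered w′ w′∈S w≢w′ w⊑w′ _ _ _ _ with only w′ w′∈S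
  ... | inj₁ refl = clash (w⊑w′ u u∈S wu) ¬xu
  ... | inj₂ w′≡w = w≢w′ (sym w′≡w)

  rank-clique : ∀ f k S v → isClique G S ≡ true → rankAux G (suc f) k S v ≡ just k
  rank-clique f k S v cl rewrite cl = refl

  rank-stuck : ∀ f k S v → isClique G S ≡ false → hasCorner G S ≡ false →
    rankAux G (suc f) k S v ≡ nothing
  rank-stuck f k S v ncl nhc rewrite ncl | nhc = refl

  rank-corner : ∀ f k S v → isClique G S ≡ false → hasCorner G S ≡ true →
    strictCorner G S v ≡ true → rankAux G (suc f) k S v ≡ just k
  rank-corner f k S v ncl hc c rewrite ncl | hc | c = refl

  rank-next : ∀ f k S v → isClique G S ≡ false → hasCorner G S ≡ true →
    strictCorner G S v ≡ false → rankAux G (suc f) k S v ≡ rankAux G f (suc k) (step G S) v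
  rank-next f k S v ncl hc nc rewrite ncl | hc | nc = refl

  rank-lower : ∀ f k S v j → rankAux G f k S v ≡ just j → k ≤ j
  rank-lower (suc f) k S v j p with isClique G S | hasCorner G S | strictCorner G S v
  ... | true  | _     | _     with p
  ...   | refl = ≤-refl
  rank-lower (suc f) k S v j p | false | true | true with p
  ...   | refl = ≤-refl
  rank-lower (suc f) k S v j p | false | true | false =
    ≤-trans (n≤1+n k) (rank-lower f (suc k) (step G S) v j p)

  isRank : Maybe ℕ → ℕ → Bool
  isRank (just m) j = m ≡ᵇ j
  isRank nothing  j = false

  isRank-below : ∀ f k S v j → j < k → isRank (rankAux G f k S v) j ≡ false
  isRank-below f k S v j j<k with rankAux G f k S v in e
  ... | nothing = refl
  ... | just r  = ≡ᵇ-false r j λ r≡j → <-irrefl refl (≤-trans j<k (subst (k ≤_) r≡j (rank-lower f k S v r e)))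

  count : ℕ → ℕ → VSet → ℕ → ℕ
  count f k S j = countB (λ v → S v ∧ isRank (rankAux G f k S v) j)

  count-nofuel : ∀ k S j → count 0 k S j ≡ 0
  count-nofuel k S j = countB-none _ λ v → ∧-zeroʳ (S v)

  count-clique-here : ∀ f k S → isClique G S ≡ true → count (suc f) k S k ≡ countB S
  count-clique-here f k S cl = countB-cong _ _ λ v →
    trans (cong (λ r → S v ∧ isRank r k) (rank-clique f k S v cl))
          (trans (cong (S v ∧_) (≡ᵇ-refl k)) (∧-identityʳ (S v)))

  count-clique-elsewhere : ∀ f k S j → k ≢ j → isClique G S ≡ true → count (suc f) k S j ≡ 0
  count-clique-elsewhere f k S j k≢j cl = countB-none _ λ v →
    trans (cong (λ r → S v ∧ isRank r j) (rank-clique f k S v cl))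
          (trans (cong (S v ∧_) (≡ᵇ-false k j k≢j)) (∧-zeroʳ (S v)))

  count-corners : ∀ f k S → isClique G S ≡ false → hasCorner G S ≡ true →
    count (suc f) k S k ≡ countB (strictCorner G S)
  count-corners f k S ncl hc = countB-cong _ _ pointwise
    where
    pointwise : ∀ v → (S v ∧ isRank (rankAux G (suc f) k S v) k) ≡ strictCorner G S v
    pointwise v = by-cases (strictCorner G S v) refl
      where
      by-cases : ∀ b → strictCorner G S v ≡ b → (S v ∧ isRank (rankAux G (suc f) k S v) k) ≡ strictCorner G S v
      by-cases true  c = trans (cong (λ r → S v ∧ isRank r k) (rank-corner f k S v ncl hc c))
                        (trans (cong (S v ∧_) (≡ᵇ-refl k)) (trans (∧-identityʳ (S v)) (trans (corner∈S S v c) (sym c))))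
      by-cases false c = trans (cong (λ r → S v ∧ isRank r k) (rank-next f k S v ncl hc c))
                        (trans (cong (S v ∧_) (isRank-below f (suc k) (step G S) v k ≤-refl))
                               (trans (∧-zeroʳ (S v)) (sym c)))

  count-next : ∀ f k S j → k < j → isClique G S ≡ false → hasCorner G S ≡ true →
    count (suc f) k S j ≡ count f (suc k) (step G S) j
  count-next f k S j k<j ncl hc = countB-cong _ _ pointwise
    where
    pointwise : ∀ v → (S v ∧ isRank (rankAux G (suc f) k S v) j)
                    ≡ ((S v ∧ not (strictCorner G S v)) ∧ isRank (rankAux G f (suc k) (step G S) v) j)
    pointwise v = by-cases (strictCorner G S v) refl
      where
      later : Bool
      later = isRank (rankAux G f (suc k) (step G S) v) j
      by-cases : ∀ b → strictCorner G S v ≡ b → (S v ∧ isRank (rankAux G (suc f) k S v) j)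
                                                ≡ ((S v ∧ not (strictCorner G S v)) ∧ later)
      by-cases true  c = trans (cong (λ r → S v ∧ isRank r j) (rank-corner f k S v ncl hc c))
        (trans (cong (S v ∧_) (≡ᵇ-false k j λ k≡j → <-irrefl k≡j k<j))
          (trans (∧-zeroʳ (S v)) (sym (trans (cong (λ b → (S v ∧ not b) ∧ later) c) (cong (_∧ later) (∧-zeroʳ (S v)))))))
      by-cases false c = trans (cong (λ r → S v ∧ isRank r j) (rank-next f k S v ncl hc c))
        (sym (trans (cong (λ b → (S v ∧ not b) ∧ later) c) (cong (_∧ later) (∧-identityʳ (S v)))))

  record Agrees (f k : ℕ) (S : VSet) : Set where
    constructor agreeing
    field
      agree : ∀ v → S v ≡ true → rank G v ≡ rankAux G f k S v
  open Agrees public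

  agrees-next : ∀ f k S → isClique G S ≡ false → hasCorner G S ≡ true →
    Agrees (suc f) k S → Agrees f (suc k) (step G S)
  agrees-next f k S ncl hc agr = agreeing λ v v∈T →
    trans (agree agr v (∧-conicalˡ _ _ v∈T)) (rank-next f k S v ncl hc (false-if-not (∧-conicalʳ (S v) _ v∈T)))

  record IsPath (S : VSet) (m : ℕ) (p : ℕ → Vertex) : Set where
    constructor mkPath
    field
      inS   : ∀ i → i < m → S (p i) ≡ true
      cover : ∀ u → S u ≡ true → Σ ℕ λ i → i < m × p i ≡ u
      inj   : ∀ i j → i < m → j < m → p i ≡ p j → i ≡ j
      pa    : ∀ i j → i < m → j < m → A (p i) (p j) ≡ padj i j

  cast-length : ∀ {S m m′ p} → m ≡ m′ → IsPath S m p → IsPath S m′ p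
  cast-length refl path = path

  pa-ordered : ∀ (q : ℕ → Vertex) m → (∀ i j → i < m → j < m → i ≤ j → A (q i) (q j) ≡ padj i j) →
    ∀ i j → i < m → j < m → A (q i) (q j) ≡ padj i j
  pa-ordered q m h i j i<m j<m with ≤-total i j
  ... | inj₁ i≤j = h i j i<m j<m i≤j
  ... | inj₂ j≤i = trans (adj-sym G (q i) (q j)) (trans (h j i j<m i<m j≤i) (padj-sym j i))

  inj-ordered : ∀ (q : ℕ → Vertex) m → (∀ i j → i < m → j < m → i < j → q i ≢ q j) →
    ∀ i j → i < m → j < m → q i ≡ q j → i ≡ j
  inj-ordered q m h i j i<m j<m e with <-cmp i j
  ... | tri< i<j _ _ = ⊥-elim (h i j i<m j<m i<j e)
  ... | tri≈ _ i≡j _ = i≡j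
  ... | tri> _ _ j<i = ⊥-elim (h j i j<m i<m j<i (sym e))

  record PathEnd (T : VSet) (e e′ e″ : Vertex) : Set where
    field
      e∈T   : T e ≡ true
      e′∈T  : T e′ ≡ true
      e″∈T  : T e″ ≡ true
      e≢e′  : e ≢ e′
      ee′   : A e e′ ≡ true
      e′e″  : A e′ e″ ≡ true
      ¬ee″  : A e e″ ≡ false
      nbrs  : ∀ u → T u ≡ true → A e u ≡ true → u ≡ e ⊎ u ≡ e′

  end-corner : ∀ {T e e′ e″} S → PathEnd T e e′ e″ → (∀ u → T u ≡ true → S u ≡ true) →
    (∀ u → S u ≡ true → T u ≡ false → A e u ≡ true → A e′ u ≡ true) → strictCorner G S e ≡ true
  end-corner {T} {e} {e′} {e″} S end T⊆S outside =
    corner-complete S e e′ e″ (T⊆S e e∈T) (T⊆S e′ e′∈T) e≢e′ e⊑e′ (T⊆S e″ e″∈T) e′e″ ¬ee″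
    where
    open PathEnd end
    e⊑e′ : Dominated S e e′
    e⊑e′ u su eu with T u in tu
    ... | false = outside u su tu eu
    ... | true with nbrs u tu eu
    ...   | inj₁ refl = A-sym e e′ ee′
    ...   | inj₂ refl = adj-refl G e′

  module PathEnds {S : VSet} {m′ : ℕ} {p : ℕ → Vertex} (path : IsPath S (suc (suc (suc m′))) p) where
    open IsPath path

    last : ℕ
    last = suc (suc m′)

    <L : ∀ {i} → i ≤ last → i < suc last
    <L = s≤s

    first-end : PathEnd S (p 0) (p 1) (p 2)
    first-end = record
      { e∈T = inS 0 (<L z≤n) ; e′∈T = inS 1 (<L (s≤s z≤n)) ; e″∈T = inS 2 (<L (s≤s (s≤s z≤n)))
      ; e≢e′ = λ e → 0≢1+n (inj 0 1 (<L z≤n) (<L (s≤s z≤n)) e)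
      ; ee′ = pa 0 1 (<L z≤n) (<L (s≤s z≤n))
      ; e′e″ = pa 1 2 (<L (s≤s z≤n)) (<L (s≤s (s≤s z≤n)))
      ; ¬ee″ = pa 0 2 (<L z≤n) (<L (s≤s (s≤s z≤n)))
      ; nbrs = nbrs }
      where
      nbrs : ∀ u → S u ≡ true → A (p 0) u ≡ true → u ≡ p 0 ⊎ u ≡ p 1
      nbrs u su a with cover u su
      ... | i , i<L , refl with below2 i (s≤s (proj₂ (padj-sound 0 i (trans (sym (pa 0 i (<L z≤n) i<L)) a))))
      ...   | inj₁ refl = inj₁ refl
      ...   | inj₂ refl = inj₂ refl

    last-end : PathEnd S (p last) (p (suc m′)) (p m′)
    last-end = record
      { e∈T = inS last ≤-refl ; e′∈T = inS (suc m′) (<L (n≤1+n _)) ; e″∈T = inS m′ (<L m′≤)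
      ; e≢e′ = λ e → <-irrefl (sym (inj last (suc m′) ≤-refl (<L (n≤1+n _)) e)) ≤-refl
      ; ee′ = trans (pa last (suc m′) ≤-refl (<L (n≤1+n _))) (padj-prev (suc m′))
      ; e′e″ = trans (pa (suc m′) m′ (<L (n≤1+n _)) (<L m′≤)) (padj-prev m′)
      ; ¬ee″ = trans (pa last m′ ≤-refl (<L m′≤)) (trans (padj-sym last m′) (padj-far m′ last ≤-refl))
      ; nbrs = nbrs }
      where
      m′≤ : m′ ≤ last
      m′≤ = ≤-trans (n≤1+n m′) (n≤1+n (suc m′))
      nbrs : ∀ u → S u ≡ true → A (p last) u ≡ true → u ≡ p last ⊎ u ≡ p (suc m′)
      nbrs u su a with cover u su
      ... | i , i<L , refl with padj-sound last i (trans (sym (pa last i ≤-refl i<L)) a)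
      ...   | last≤1+i , _ with m≤n⇒m<n∨m≡n (≤-pred i<L)
      ...     | inj₂ refl = inj₁ refl
      ...     | inj₁ i<last with ≤-antisym (≤-pred i<last) (≤-pred last≤1+i)
      ...       | refl = inj₂ refl

    far : A (p 0) (p last) ≡ false
    far = pa 0 last (<L z≤n) ≤-refl

    not-clique : isClique G S ≡ false
    not-clique = false-if-not-true λ cl →
      clash (clique-sound S cl (p 0) (p 2) (PathEnd.e∈T first-end) (PathEnd.e″∈T first-end)) (PathEnd.¬ee″ first-end)

    first-corner : strictCorner G S (p 0) ≡ true
    first-corner = end-corner S first-end (λ _ t → t) λ u su tu _ → ⊥-elim (clash su tu)

    last-corner : strictCorner G S (p last) ≡ true
    last-corner = end-corner S last-end (λ _ t → t) λ u su tu _ → ⊥-elim (clash su tu)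

    has-corner : hasCorner G S ≡ true
    has-corner = anyB-complete _ (p 0) first-corner

    -- A dominator of an inner vertex p (i+1) is adjacent to p i and p (i+2), hence is p (i+1).
    inner-not-corner : ∀ i → i ≤ m′ → strictCorner G S (p (suc i)) ≡ false
    inner-not-corner i i≤m′ = false-if-not-true λ c → no-dominator (corner-sound S (p (suc i)) c)
      where
      i<L : i < suc last
      i<L = <L (≤-trans i≤m′ (≤-trans (n≤1+n m′) (n≤1+n (suc m′))))
      1+i<L : suc i < suc last
      1+i<L = <L (s≤s (≤-trans i≤m′ (n≤1+n m′)))
      2+i<L : suc (suc i) < suc last
      2+i<L = <L (s≤s (s≤s i≤m′))
      no-dominator : Cornered S (p (suc i)) → ⊥
      no-dominator (cornered w w∈S v≢w v⊑w _ _ _ _) with cover w w∈S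
      ... | j , j<L , refl = v≢w (cong p (sym (≤-antisym (proj₁ (padj-sound j i j~i)) (≤-pred (proj₂ (padj-sound j (suc (suc i)) j~2+i))))))
        where
        j~i : padj j i ≡ true
        j~i = trans (sym (pa j i j<L i<L)) (v⊑w (p i) (inS i i<L) (trans (pa (suc i) i 1+i<L i<L) (padj-prev i)))
        j~2+i : padj j (suc (suc i)) ≡ true
        j~2+i = trans (sym (pa j (suc (suc i)) j<L 2+i<L))
                      (v⊑w (p (suc (suc i))) (inS _ 2+i<L) (trans (pa (suc i) (suc (suc i)) 1+i<L 2+i<L) (padj-next (suc i))))

    corners-are-ends : Only2 (strictCorner G S) (p 0) (p last)
    corners-are-ends u c with cover u (corner∈S S u c)
    ... | zero , _ , refl = inj₁ refl
    ... | suc i , i<L , refl with m≤n⇒m<n∨m≡n (≤-pred i<L)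
    ...   | inj₂ refl = inj₂ refl
    ...   | inj₁ i<last = ⊥-elim (clash c (inner-not-corner i (≤-pred (≤-pred i<last))))

    corner-count : countB (strictCorner G S) ≡ 2
    corner-count = countB-two (strictCorner G S) (p 0) (p last)
      (λ e → 0≢1+n (inj 0 last (<L z≤n) ≤-refl e)) first-corner last-corner corners-are-ends

    inner : IsPath (step G S) (suc m′) (p ∘ suc)
    inner = mkPath inT coverT
      (λ i j i< j< e → suc-injective (inj (suc i) (suc j) (up i<) (up j<) e))
      (λ i j i< j< → trans (pa (suc i) (suc j) (up i<) (up j<)) (padj-suc i j))
      where
      up : ∀ {i} → i < suc m′ → suc i < suc last
      up i< = s≤s (≤-trans i< (n≤1+n _))
      inT : ∀ i → i < suc m′ → step G S (p (suc i)) ≡ true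
      inT i i< = ∧-intro (inS (suc i) (up i<)) (cong not (inner-not-corner i (≤-pred i<)))
      coverT : ∀ u → step G S u ≡ true → Σ ℕ λ i → i < suc m′ × p (suc i) ≡ u
      coverT u u∈T with cover u (∧-conicalˡ _ _ u∈T)
      ... | zero , _ , refl = ⊥-elim (clash first-corner (false-if-not (∧-conicalʳ (S (p 0)) _ u∈T)))
      ... | suc i , i<L , refl with m≤n⇒m<n∨m≡n (≤-pred i<L)
      ...   | inj₂ refl = ⊥-elim (clash last-corner (false-if-not (∧-conicalʳ (S (p last)) _ u∈T)))
      ...   | inj₁ i<last = i , ≤-pred i<last , refl

  short-clique : ∀ {S L p} → IsPath S L p → L ≤ 2 → isClique G S ≡ true
  short-clique {S} {L} {p} path L≤2 = clique-complete S λ u v su sv → adjacent (cover u su) (cover v sv)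
    where
    open IsPath path
    adjacent : ∀ {u v} → (Σ ℕ λ i → i < L × p i ≡ u) → (Σ ℕ λ i → i < L × p i ≡ v) → A u v ≡ true
    adjacent (i , i<L , refl) (j , j<L , refl) with below2 i (≤-trans i<L L≤2) | below2 j (≤-trans j<L L≤2)
    ... | inj₁ refl | inj₁ refl = pa 0 0 i<L j<L
    ... | inj₁ refl | inj₂ refl = pa 0 1 i<L j<L
    ... | inj₂ refl | inj₁ refl = pa 1 0 i<L j<L
    ... | inj₂ refl | inj₂ refl = pa 1 1 i<L j<L

  data GluedIndex (m : ℕ) : ℕ → Set where
    at-start : GluedIndex m 0
    at-old   : ∀ i → i < m → GluedIndex m (suc i)
    at-end   : GluedIndex m (suc m)

  glued-index : ∀ m i → i < suc (suc m) → GluedIndex m i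
  glued-index m       zero          _ = at-start
  glued-index zero    (suc zero)    _ = at-end
  glued-index zero    (suc (suc i)) (s≤s (s≤s ()))
  glued-index (suc m) (suc i)       (s≤s i<) with glued-index m i i<
  ... | at-start   = at-old 0 (s≤s z≤n)
  ... | at-old j j< = at-old (suc j) (s≤s j<)
  ... | at-end     = at-end

  -- The strict corners of S are x and y (possibly x ≡ y): all other vertices
  -- survive into the next round.
  record CornersAmong (S : VSet) (x y : Vertex) : Set where
    field
      x-corner : strictCorner G S x ≡ true
      y-corner : strictCorner G S y ≡ true
      cov      : ∀ u → S u ≡ true → step G S u ≡ true ⊎ (u ≡ x ⊎ u ≡ y)

  survives-or-corner : ∀ S u → S u ≡ true → step G S u ≡ true ⊎ strictCorner G S u ≡ true
  survives-or-corner S u su with strictCorner G S u in c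
  ... | true  = inj₂ refl
  ... | false = inj₁ (trans (∧-identityʳ (S u)) su)

  two-corners : ∀ S → countB (strictCorner G S) ≡ 2 → Σ Vertex λ x → Σ Vertex λ y → x ≢ y × CornersAmong S x y
  two-corners S c2 with countB-two-inv (strictCorner G S) c2
  ... | x , y , x≢y , cx , cy , only = x , y , x≢y , record { x-corner = cx ; y-corner = cy ; cov = cov }
    where
    cov : ∀ u → S u ≡ true → step G S u ≡ true ⊎ (u ≡ x ⊎ u ≡ y)
    cov u su = ⊎-map₂ (only u) (survives-or-corner S u su)

  one-corner : ∀ S → countB (strictCorner G S) ≡ 1 → Σ Vertex λ x → CornersAmong S x x
  one-corner S c1 with countB-one-inv (strictCorner G S) c1
  ... | x , cx , only = x , record { x-corner = cx ; y-corner = cx ; cov = cov }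
    where
    cov : ∀ u → S u ≡ true → step G S u ≡ true ⊎ (u ≡ x ⊎ u ≡ x)
    cov u su = ⊎-map₂ (inj₁ ∘ only u) (survives-or-corner S u su)

  -- If T is an induced path, the corners attach to its ends and S is again a path.
  module Unpeel {S : VSet} {x y : Vertex} (among : CornersAmong S x y) where
    open CornersAmong among

    T : VSet
    T = step G S

    T⊆S : ∀ u → T u ≡ true → S u ≡ true
    T⊆S u = ∧-conicalˡ _ _

    T-no-corner : ∀ u → T u ≡ true → strictCorner G S u ≡ false
    T-no-corner u u∈T = false-if-not (∧-conicalʳ (S u) _ u∈T)

    Corner : Vertex → Set
    Corner z = z ≡ x ⊎ z ≡ y

    corner-of : ∀ {z} → Corner z → strictCorner G S z ≡ true
    corner-of (inj₁ refl) = x-corner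
    corner-of (inj₂ refl) = y-corner

    outside-T : ∀ u → S u ≡ true → T u ≡ false → Corner u
    outside-T u su tu with cov u su
    ... | inj₁ t  = ⊥-elim (clash t tu)
    ... | inj₂ c  = c

    corner-outside-T : ∀ z → strictCorner G S z ≡ true → T z ≡ false
    corner-outside-T z c = trans (cong (λ b → S z ∧ not b) c) (∧-zeroʳ (S z))

    corner-is : ∀ z → strictCorner G S z ≡ true → Corner z
    corner-is z c = outside-T z (corner∈S S z c) (corner-outside-T z c)

    pigeonhole : ∀ {a b c} → Corner a → Corner b → Corner c → a ≢ b → b ≢ c → a ≡ c
    pigeonhole (inj₁ refl) (inj₁ refl) _           a≢b _   = ⊥-elim (a≢b refl)
    pigeonhole (inj₂ refl) (inj₂ refl) _           a≢b _   = ⊥-elim (a≢b refl)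
    pigeonhole _           (inj₁ refl) (inj₁ refl) _   b≢c = ⊥-elim (b≢c refl)
    pigeonhole _           (inj₂ refl) (inj₂ refl) _   b≢c = ⊥-elim (b≢c refl)
    pigeonhole (inj₁ refl) (inj₂ refl) (inj₁ refl) _   _   = refl
    pigeonhole (inj₂ refl) (inj₁ refl) (inj₂ refl) _   _   = refl

    -- Every corner is dominated by a vertex of T: follow dominators; a chain of two
    -- corners cannot return to its start, since domination would then be mutual.
    dominator-in-T : ∀ z → strictCorner G S z ≡ true → Σ Vertex λ w → T w ≡ true × Dominated S z w
    dominator-in-T z cz with corner-sound S z cz
    ... | cornered w w∈S z≢w z⊑w u u∈S wu ¬zu with T w in tw
    ...   | true  = w , tw , z⊑w
    ...   | false with corner-sound S w (corner-of (outside-T w w∈S tw))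
    ...     | cornered w′ w′∈S w≢w′ w⊑w′ _ _ _ _ with T w′ in tw′
    ...       | true  = w′ , tw′ , dominated-trans z⊑w w⊑w′
    ...       | false with pigeonhole (corner-is z cz) (outside-T w w∈S tw) (outside-T w′ w′∈S tw′) z≢w w≢w′
    ...         | refl = ⊥-elim (clash (w⊑w′ u u∈S wu) ¬zu)

    record Attached (e e′ : Vertex) : Set where
      constructor attached
      field
        z    : Vertex
        z∈xy : Corner z
        ze   : A z e ≡ true
        ¬ze′ : A z e′ ≡ false
        z⊑e  : Dominated S z e

    -- Some corner attaches at each end e of T: otherwise e′ would dominate e in S,
    -- making the vertex e of T a strict corner of S.  Its dominator in T must be e.
    attach-at : ∀ {e e′ e″} → PathEnd T e e′ e″ → Attached e e′
    attach-at {e} {e′} end =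
      try x (inj₁ refl) λ x-follows → try y (inj₂ refl) λ y-follows →
        ⊥-elim (clash (end-corner S end T⊆S (e′-covers x-follows y-follows)) (T-no-corner e e∈T))
      where
      open PathEnd end
      attaches : ∀ z → Corner z → A z e ≡ true → A z e′ ≡ false → Attached e e′
      attaches z cz ze ¬ze′ with dominator-in-T z (corner-of cz)
      ... | w , w∈T , z⊑w with nbrs w w∈T (A-sym w e (z⊑w e (T⊆S e e∈T) ze))
      ...   | inj₁ refl = attached z cz ze ¬ze′ z⊑w
      ...   | inj₂ refl = ⊥-elim (clash (A-sym e′ z (dominator-adj (corner∈S S z (corner-of cz)) z⊑w)) ¬ze′)
      try : ∀ z → Corner z → ((A z e ≡ true → A z e′ ≡ true) → Attached e e′) → Attached e e′
      try z cz k with A z e in ze | A z e′ in ze′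
      ... | true  | false = attaches z cz ze ze′
      ... | true  | true  = k λ _ → refl
      ... | false | _     = k λ ()
      e′-covers : (A x e ≡ true → A x e′ ≡ true) → (A y e ≡ true → A y e′ ≡ true) →
        ∀ u → S u ≡ true → T u ≡ false → A e u ≡ true → A e′ u ≡ true
      e′-covers hx hy u su tu eu with outside-T u su tu
      ... | inj₁ refl = A-sym x e′ (hx (A-sym e x eu))
      ... | inj₂ refl = A-sym y e′ (hy (A-sym e y eu))

    record Pendants (m₀ : ℕ) (p : ℕ → Vertex) : Set where
      constructor pendants
      field
        a b     : Vertex
        a∈xy    : Corner a
        b∈xy    : Corner b
        a≢b     : a ≢ b
        a-nbrs  : ∀ i → i < suc m₀ → A a (p i) ≡ true → i ≡ 0
        a-first : A a (p 0) ≡ true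
        b-nbrs  : ∀ i → i < suc m₀ → A b (p i) ≡ true → i ≡ m₀
        b-last  : A b (p m₀) ≡ true
        ¬ab     : A a b ≡ false

    no-pendants-for-one-corner : ∀ {m₀ p} → x ≡ y → Pendants m₀ p → ⊥
    no-pendants-for-one-corner refl P = a≢b (trans (is-x a∈xy) (sym (is-x b∈xy)))
      where
      open Pendants P
      is-x : ∀ {z} → Corner z → z ≡ x
      is-x (inj₁ e) = e
      is-x (inj₂ e) = e

    either : ∀ {a b u} → Corner a → Corner b → a ≢ b → Corner u → u ≡ a ⊎ u ≡ b
    either (inj₁ refl) _           _   (inj₁ refl) = inj₁ refl
    either (inj₂ refl) _           _   (inj₂ refl) = inj₁ refl
    either (inj₁ refl) (inj₂ refl) _   (inj₂ refl) = inj₂ refl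
    either (inj₂ refl) (inj₁ refl) _   (inj₁ refl) = inj₂ refl
    either (inj₁ refl) (inj₁ refl) a≢b (inj₂ _)    = ⊥-elim (a≢b refl)
    either (inj₂ refl) (inj₂ refl) a≢b (inj₁ _)    = ⊥-elim (a≢b refl)

    module Glue {m₀ : ℕ} {p : ℕ → Vertex} (P : Pendants m₀ p) (path : IsPath T (suc m₀) p) where
      open Pendants P
      open IsPath path

      m : ℕ
      m = suc m₀

      q : ℕ → Vertex
      q zero    = a
      q (suc i) = if i ≡ᵇ m then b else p i

      q-old : ∀ i → i < m → q (suc i) ≡ p i
      q-old i i<m rewrite ≡ᵇ-false i m (λ e → <-irrefl e i<m) = refl

      q-end : q (suc m) ≡ b
      q-end rewrite ≡ᵇ-refl m = refl

      a∉T : T a ≡ false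
      a∉T = corner-outside-T a (corner-of a∈xy)

      b∉T : T (q (suc m)) ≡ false
      b∉T = trans (cong T q-end) (corner-outside-T b (corner-of b∈xy))

      old∈T : ∀ i → i < m → T (q (suc i)) ≡ true
      old∈T i i< = trans (cong T (q-old i i<)) (inS i i<)

      glued-inS : ∀ i → i < suc (suc m) → S (q i) ≡ true
      glued-inS i i< with glued-index m i i<
      ... | at-start    = corner∈S S a (corner-of a∈xy)
      ... | at-old j j< = T⊆S _ (old∈T j j<)
      ... | at-end rewrite q-end = corner∈S S b (corner-of b∈xy)

      glued-cover : ∀ u → S u ≡ true → Σ ℕ λ i → i < suc (suc m) × q i ≡ u
      glued-cover u su with cov u su
      ... | inj₁ tu = let (i , i< , e) = cover u tu in suc i , s≤s (≤-trans i< (n≤1+n m)) , trans (q-old i i<) e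
      ... | inj₂ c with either a∈xy b∈xy a≢b c
      ...   | inj₁ refl = 0 , s≤s z≤n , refl
      ...   | inj₂ refl = suc m , ≤-refl , q-end

      glued-distinct : ∀ i j → i < suc (suc m) → j < suc (suc m) → i < j → q i ≢ q j
      glued-distinct i j i< j< i<j e with glued-index m i i< | glued-index m j j<
      ... | at-start      | at-start      = <-irrefl refl i<j
      ... | at-start      | at-old j′ j′< = clash (trans (cong T e) (old∈T j′ j′<)) a∉T
      ... | at-start      | at-end        = a≢b (trans e q-end)
      ... | at-old i′ i′< | at-start      = clash (trans (cong T (sym e)) (old∈T i′ i′<)) a∉T
      ... | at-old i′ i′< | at-old j′ j′< =
        <-irrefl (cong suc (inj i′ j′ i′< j′< (trans (sym (q-old i′ i′<)) (trans e (q-old j′ j′<))))) i<j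
      ... | at-old i′ i′< | at-end        = clash (trans (cong T (sym e)) (old∈T i′ i′<)) b∉T
      ... | at-end        | at-start      = a≢b (sym (trans (sym q-end) e))
      ... | at-end        | at-old j′ j′< = clash (trans (cong T e) (old∈T j′ j′<)) b∉T
      ... | at-end        | at-end        = <-irrefl refl i<j

      a-adjacency : ∀ j → j < m → A a (p j) ≡ padj 0 (suc j)
      a-adjacency zero     _  = a-first
      a-adjacency (suc j′) j< = false-if-not-true λ e → 1+n≢0 (a-nbrs (suc j′) j< e)

      b-adjacency : ∀ i → i < m → A (p i) b ≡ padj (suc i) (suc m)
      b-adjacency i i< with m≤n⇒m<n∨m≡n (≤-pred i<)
      ... | inj₂ refl = trans (A-sym b (p m₀) b-last) (sym (trans (padj-suc m₀ m) (padj-next m₀)))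
      ... | inj₁ i<m₀ = trans (false-if-not-true λ e → <-irrefl (b-nbrs i i< (A-sym (p i) b e)) i<m₀)
                              (sym (trans (padj-suc i m) (padj-far i m (s≤s i<m₀))))

      glued-adjacency : ∀ i j → i < suc (suc m) → j < suc (suc m) → i ≤ j → A (q i) (q j) ≡ padj i j
      glued-adjacency i j i< j< i≤j with glued-index m i i< | glued-index m j j<
      ... | at-start      | at-start      = adj-refl G a
      ... | at-start      | at-old j′ j′< rewrite q-old j′ j′< = a-adjacency j′ j′<
      ... | at-start      | at-end        rewrite q-end = ¬ab
      ... | at-old i′ i′< | at-old j′ j′< rewrite q-old i′ i′< | q-old j′ j′< =
        trans (pa i′ j′ i′< j′<) (sym (padj-suc i′ j′))
      ... | at-old i′ i′< | at-end        rewrite q-old i′ i′< | q-end = b-adjacency i′ i′<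
      ... | at-end        | at-end        = trans (adj-refl G _) (sym (padj-refl (suc m)))
      ... | at-old _ _    | at-start      = ⊥-elim (n≮0 i≤j)
      ... | at-end        | at-start      = ⊥-elim (n≮0 i≤j)
      ... | at-end        | at-old j′ j′< = ⊥-elim (<-irrefl refl (≤-trans j′< (≤-pred i≤j)))

      glued : IsPath S (suc (suc m)) q
      glued = mkPath glued-inS glued-cover (inj-ordered q _ glued-distinct) (pa-ordered q _ glued-adjacency)

    -- Gluing onto a path whose length is only propositionally of the form m₀ + 1.
    grow : ∀ {ℓ m₀ p} → ℓ ≡ suc m₀ → Pendants m₀ p → IsPath T ℓ p → Σ (ℕ → Vertex) λ q → IsPath S (suc (suc ℓ)) q
    grow refl P path = Glue.q P path , Glue.glued P path

    -- T a single vertex: both corners hang from it, and x ≁ y, since otherwise x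
    -- would be adjacent to all of S and so not a strict corner.
    pendants-on-vertex : ∀ {p} → x ≢ y → IsPath T 1 p → Pendants 0 p
    pendants-on-vertex {p} x≢y path =
      pendants x y (inj₁ refl) (inj₂ refl) x≢y only-0 (hangs x-corner) only-0 (hangs y-corner) ¬xy
      where
      open IsPath path
      only-0 : ∀ {c : ℕ → Bool} i → i < 1 → c i ≡ true → i ≡ 0
      only-0 zero    _ _ = refl
      only-0 (suc i) (s≤s ()) _
      only : ∀ u → T u ≡ true → u ≡ p 0
      only u tu with cover u tu
      ... | zero , _ , e = sym e
      ... | suc i , s≤s () , _
      hangs : ∀ {z} → strictCorner G S z ≡ true → A z (p 0) ≡ true
      hangs {z} cz = let (w , w∈T , z⊑w) = dominator-in-T z cz in
        subst (λ v → A z v ≡ true) (only w w∈T) (A-sym w z (dominator-adj (corner∈S S z cz) z⊑w))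
      ¬xy : A x y ≡ false
      ¬xy = false-if-not-true λ xy → full-not-corner S x (x-sees xy) x-corner
        where
        x-sees : A x y ≡ true → Full S x
        x-sees xy u su with cov u su
        ... | inj₁ tu          = subst (λ v → A x v ≡ true) (sym (only u tu)) (hangs x-corner)
        ... | inj₂ (inj₁ refl) = adj-refl G x
        ... | inj₂ (inj₂ refl) = xy

    -- Each corner is
    -- dominated by an end; a common dominator would see all of S, so the corners hang
    -- from different ends, each seeing only its own end.
    module OnEdge {p : ℕ → Vertex} (no-full : ∀ t → T t ≡ true → Full S t → ⊥) (path : IsPath T 2 p) where
      open IsPath path
      0<2 : 0 < 2
      0<2 = s≤s z≤n
      1<2 : 1 < 2
      1<2 = s≤s (s≤s z≤n)
      dominator-index : ∀ {z} → strictCorner G S z ≡ true → Σ ℕ λ j → j < 2 × Dominated S z (p j)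
      dominator-index {z} cz with dominator-in-T z cz
      ... | w , w∈T , z⊑w with cover w w∈T
      ...   | j , j< , refl = j , j< , z⊑w
      not-full : ∀ j → j < 2 → (∀ z → Corner z → A (p j) z ≡ true) → ⊥
      not-full j j< sees = no-full (p j) (inS j j<) λ u su → sees-u u (cov u su)
        where
        sees-u : ∀ u → T u ≡ true ⊎ Corner u → A (p j) u ≡ true
        sees-u u (inj₁ tu) = clique-sound T (short-clique path ≤-refl) (p j) u (inS j j<) tu
        sees-u u (inj₂ c)  = sees u c
      dominator-sees : ∀ {z j} → Corner z → Dominated S z (p j) → A (p j) z ≡ true
      dominator-sees c z⊑ = dominator-adj (corner∈S S _ (corner-of c)) z⊑
      pendants-from : ∀ a b → Corner a → Corner b → (∀ z → Corner z → z ≡ a ⊎ z ≡ b) →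
        Dominated S a (p 0) → Dominated S b (p 1) → Pendants 1 p
      pendants-from a b a∈xy b∈xy a-or-b a⊑p0 b⊑p1 =
        pendants a b a∈xy b∈xy a≢b a-nbrs (A-sym (p 0) a (dominator-sees a∈xy a⊑p0))
                 b-nbrs (A-sym (p 1) b (dominator-sees b∈xy b⊑p1)) ¬ab
        where
        sees-both : ∀ j → A (p j) a ≡ true → A (p j) b ≡ true → ∀ z → Corner z → A (p j) z ≡ true
        sees-both j ja jb z c with a-or-b z c
        ... | inj₁ refl = ja
        ... | inj₂ refl = jb
        p0≁b : A (p 0) b ≡ true → ⊥
        p0≁b e = not-full 0 0<2 (sees-both 0 (dominator-sees a∈xy a⊑p0) e)
        p1≁a : A (p 1) a ≡ true → ⊥
        p1≁a e = not-full 1 1<2 (sees-both 1 e (dominator-sees b∈xy b⊑p1))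
        a≢b : a ≢ b
        a≢b refl = p0≁b (dominator-sees a∈xy a⊑p0)
        a-nbrs : ∀ i → i < 2 → A a (p i) ≡ true → i ≡ 0
        a-nbrs i i< e with below2 i i<
        ... | inj₁ i≡0 = i≡0
        ... | inj₂ refl = ⊥-elim (p1≁a (A-sym a (p 1) e))
        b-nbrs : ∀ i → i < 2 → A b (p i) ≡ true → i ≡ 1
        b-nbrs i i< e with below2 i i<
        ... | inj₂ i≡1 = i≡1
        ... | inj₁ refl = ⊥-elim (p0≁b (A-sym b (p 0) e))
        ¬ab : A a b ≡ false
        ¬ab = false-if-not-true λ e → p0≁b (a⊑p0 b (corner∈S S b (corner-of b∈xy)) e)
      choose : (Σ ℕ λ j → j < 2 × Dominated S x (p j)) → (Σ ℕ λ j → j < 2 × Dominated S y (p j)) → Pendants 1 p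
      choose (jx , jx< , x⊑) (jy , jy< , y⊑) with below2 jx jx< | below2 jy jy<
      ... | inj₁ refl | inj₂ refl = pendants-from x y (inj₁ refl) (inj₂ refl) (λ _ c → c) x⊑ y⊑
      ... | inj₂ refl | inj₁ refl = pendants-from y x (inj₂ refl) (inj₁ refl) (λ _ c → swap c) y⊑ x⊑
      ... | inj₁ refl | inj₁ refl = ⊥-elim (not-full 0 0<2 (both x⊑ y⊑))
        where
        both : Dominated S x (p 0) → Dominated S y (p 0) → ∀ z → Corner z → A (p 0) z ≡ true
        both x⊑ _ z (inj₁ refl) = dominator-sees (inj₁ refl) x⊑
        both _ y⊑ z (inj₂ refl) = dominator-sees (inj₂ refl) y⊑
      ... | inj₂ refl | inj₂ refl = ⊥-elim (not-full 1 1<2 (both x⊑ y⊑))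
        where
        both : Dominated S x (p 1) → Dominated S y (p 1) → ∀ z → Corner z → A (p 1) z ≡ true
        both x⊑ _ z (inj₁ refl) = dominator-sees (inj₁ refl) x⊑
        both _ y⊑ z (inj₂ refl) = dominator-sees (inj₂ refl) y⊑

      edge-pendants : Pendants 1 p
      edge-pendants = choose (dominator-index x-corner) (dominator-index y-corner)

    pendants-on-edge : ∀ {p} → (∀ t → T t ≡ true → Full S t → ⊥) → IsPath T 2 p → Pendants 1 p
    pendants-on-edge no-full path = OnEdge.edge-pendants no-full path

    -- T a path on at least three vertices: a corner attaches at each end; they differ
    -- and are non-adjacent, as their neighbourhoods lie in those of the non-adjacent ends.
    pendants-on-long-path : ∀ {m′ p} → IsPath T (suc (suc (suc m′))) p → Pendants (suc (suc m′)) p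
    pendants-on-long-path {m′} {p} path = from (attach-at first-end) (attach-at last-end)
      where
      open IsPath path
      open PathEnds path
      from : Attached (p 0) (p 1) → Attached (p last) (p (suc m′)) → Pendants last p
      from (attached a a∈xy a0 ¬a1 a⊑p0) (attached b b∈xy bl ¬bl′ b⊑pl) =
        pendants a b a∈xy b∈xy a≢b a-nbrs a0 b-nbrs bl ¬ab
        where
        in-S : ∀ i → i < suc last → S (p i) ≡ true
        in-S i i< = T⊆S (p i) (inS i i<)
        a≢b : a ≢ b
        a≢b refl = clash (a⊑p0 (p last) (in-S last ≤-refl) bl) far
        a-nbrs : ∀ i → i < suc last → A a (p i) ≡ true → i ≡ 0
        a-nbrs i i< e with PathEnd.nbrs first-end (p i) (inS i i<) (a⊑p0 (p i) (in-S i i<) e)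
        ... | inj₁ q = inj i 0 i< (s≤s z≤n) q
        ... | inj₂ q = ⊥-elim (clash (trans (cong (A a) (sym q)) e) ¬a1)
        b-nbrs : ∀ i → i < suc last → A b (p i) ≡ true → i ≡ last
        b-nbrs i i< e with PathEnd.nbrs last-end (p i) (inS i i<) (b⊑pl (p i) (in-S i i<) e)
        ... | inj₁ q = inj i last i< ≤-refl q
        ... | inj₂ q = ⊥-elim (clash (trans (cong (A b) (sym q)) e) ¬bl′)
        ¬ab : A a b ≡ false
        ¬ab = false-if-not-true λ e →
          clash (A-sym (p last) (p 0) (b⊑pl (p 0) (in-S 0 (s≤s z≤n))
                  (A-sym (p 0) b (a⊑p0 b (corner∈S S b (corner-of b∈xy)) e)))) far

  short-path-size : ∀ {S r′ p} → r′ ≤ 1 → IsPath S (suc r′) p → countB S ≡ suc r′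
  short-path-size {S} {p = p} z≤n path = countB-one S (p 0) (inS 0 (s≤s z≤n)) only
    where
    open IsPath path
    only : Only S (p 0)
    only u su with cover u su
    ... | zero , _ , e = sym e
    ... | suc i , s≤s () , _
  short-path-size {S} {p = p} (s≤s z≤n) path =
    countB-two S (p 0) (p 1) (λ e → 0≢1+n (inj 0 1 0<2 1<2 e)) (inS 0 0<2) (inS 1 1<2) only
    where
    open IsPath path
    0<2 : 0 < 2
    0<2 = s≤s z≤n
    1<2 : 1 < 2
    1<2 = s≤s (s≤s z≤n)
    only : Only2 S (p 0) (p 1)
    only u su with cover u su
    ... | i , i< , refl with below2 i i<
    ...   | inj₁ refl = inj₁ refl
    ...   | inj₂ refl = inj₂ refl

  RankProfile : ℕ → ℕ → ℕ → ℕ → VSet → Set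
  RankProfile d r f k S =
      (∀ v → S v ≡ true → Σ ℕ λ j → rankAux G f k S v ≡ just j × j ≤ k + d)
    × count f k S (k + d) ≡ r
    × (∀ j → j < d → count f k S (k + j) ≡ 2)

  path-ranks : ∀ d r′ f k S p → r′ ≤ 1 → d < f → IsPath S (suc r′ + (d + d)) p → RankProfile d (suc r′) f k S
  path-ranks zero r′ (suc f) k S p r′≤1 _ path = ranks , top , λ _ ()
    where
    path′ : IsPath S (suc r′) p
    path′ = cast-length (cong suc (+-identityʳ r′)) path
    clique : isClique G S ≡ true
    clique = short-clique path′ (s≤s r′≤1)
    ranks : ∀ v → S v ≡ true → Σ ℕ λ j → rankAux G (suc f) k S v ≡ just j × j ≤ k + 0
    ranks v _ = k , rank-clique f k S v clique , m≤m+n k 0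
    top : count (suc f) k S (k + 0) ≡ suc r′
    top = trans (cong (count (suc f) k S) (+-identityʳ k))
                (trans (count-clique-here f k S clique) (short-path-size r′≤1 path′))
  path-ranks (suc d) r′ (suc f) k S p r′≤1 (s≤s d<f) path = ranks , top , below
    where
    open PathEnds (cast-length (peel-length (suc r′) d) path)
    IH : RankProfile d (suc r′) f (suc k) (step G S)
    IH = path-ranks d r′ f (suc k) (step G S) (p ∘ suc) r′≤1 d<f inner
    later : ∀ j → count (suc f) k S (k + suc j) ≡ count f (suc k) (step G S) (suc k + j)
    later j = trans (count-next f k S (k + suc j) (m<m+n k (s≤s z≤n)) not-clique has-corner)
                    (cong (count f (suc k) (step G S)) (+-suc k j))
    ranks : ∀ v → S v ≡ true → Σ ℕ λ j → rankAux G (suc f) k S v ≡ just j × j ≤ k + suc d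
    ranks v sv = by-cases (strictCorner G S v) refl
      where
      by-cases : ∀ b → strictCorner G S v ≡ b → Σ ℕ λ j → rankAux G (suc f) k S v ≡ just j × j ≤ k + suc d
      by-cases true  c = k , rank-corner f k S v not-clique has-corner c , m≤m+n k (suc d)
      by-cases false c =
        let (j , rj , j≤) = proj₁ IH v (trans (cong (λ b → S v ∧ not b) c) (trans (∧-identityʳ (S v)) sv)) in
        j , trans (rank-next f k S v not-clique has-corner c) rj , subst (j ≤_) (sym (+-suc k d)) j≤
    top : count (suc f) k S (k + suc d) ≡ suc r′
    top = trans (later d) (proj₁ (proj₂ IH))
    below : ∀ j → j < suc d → count (suc f) k S (k + j) ≡ 2
    below zero    _ = trans (cong (count (suc f) k S) (+-identityʳ k))
                            (trans (count-corners f k S not-clique has-corner) corner-count)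
    below (suc j) j< = trans (later j) (proj₂ (proj₂ IH) j (≤-pred j<))

  stage-path : ∀ {m r} → IsPath (allV G) m r → ∀ k L → L + (k + k) ≡ m → 1 ≤ L →
    Σ (ℕ → Vertex) λ p → IsPath (stage G (suc k)) L p × (∀ i → p i ≡ r (k + i))
  stage-path {r = r} path zero L L≡m _ = r , cast-length (trans (sym L≡m) (+-identityʳ L)) path , λ i → refl
  stage-path {m} {r} path (suc k) (suc L) L≡m _
    with stage-path path k (suc (suc (suc L))) (trans (sym (peel-length (suc L) k)) L≡m) (s≤s z≤n)
  ... | p , path′ , p≡r = p ∘ suc , PathEnds.inner path′ , λ i → trans (p≡r (suc i)) (cong r (+-suc k i))

  vertex-path : ∀ {S a} → S a ≡ true → Only S a → IsPath S 1 (λ _ → a)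
  vertex-path {a = a} a∈S only = mkPath (λ _ _ → a∈S) (λ u su → 0 , s≤s z≤n , sym (only u su))
    (λ { zero zero _ _ _ → refl ; (suc i) _ (s≤s ()) _ _ ; zero (suc j) _ (s≤s ()) _ })
    (λ { zero zero _ _ → adj-refl G a ; (suc i) _ (s≤s ()) _ ; zero (suc j) _ (s≤s ()) })

  edge-path : ∀ {S a b} → a ≢ b → S a ≡ true → S b ≡ true → Only2 S a b → A a b ≡ true →
    Σ (ℕ → Vertex) λ p → IsPath S 2 p
  edge-path {S} {a} {b} a≢b a∈S b∈S only ab = p , mkPath inS cover inj pa
    where
    p : ℕ → Vertex
    p zero    = a
    p (suc _) = b
    inS : ∀ i → i < 2 → S (p i) ≡ true
    inS zero    _ = a∈S
    inS (suc _) _ = b∈S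
    cover : ∀ u → S u ≡ true → Σ ℕ λ i → i < 2 × p i ≡ u
    cover u su with only u su
    ... | inj₁ refl = 0 , s≤s z≤n , refl
    ... | inj₂ refl = 1 , s≤s (s≤s z≤n) , refl
    inj : ∀ i j → i < 2 → j < 2 → p i ≡ p j → i ≡ j
    inj i j i< j< e with below2 i i< | below2 j j<
    ... | inj₁ refl | inj₁ refl = refl
    ... | inj₁ refl | inj₂ refl = ⊥-elim (a≢b e)
    ... | inj₂ refl | inj₁ refl = ⊥-elim (a≢b (sym e))
    ... | inj₂ refl | inj₂ refl = refl
    pa : ∀ i j → i < 2 → j < 2 → A (p i) (p j) ≡ padj i j
    pa i j i< j< with below2 i i< | below2 j j<
    ... | inj₁ refl | inj₁ refl = adj-refl G a
    ... | inj₁ refl | inj₂ refl = ab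
    ... | inj₂ refl | inj₁ refl = A-sym a b ab
    ... | inj₂ refl | inj₂ refl = adj-refl G b

  module Reconstruction (cop-win : CopWin G) (α : ℕ) (bounded : ∀ v j → rank G v ≡ just j → j ≤ α) where

    rank-range : ∀ {f k S} → Agrees f k S → ∀ v → S v ≡ true →
      Σ ℕ λ j → rankAux G f k S v ≡ just j × k ≤ j × j ≤ α
    rank-range {f} {k} {S} agr v sv with rankAux G f k S v in e
    ... | nothing = ⊥-elim (cop-win v (trans (agree agr v sv) e))
    ... | just j  = j , refl , rank-lower f k S v j e , bounded v j (trans (agree agr v sv) e)

    at-top : ∀ {f k S} → Agrees f k S → α ≡ k → ∀ t → S t ≡ true → rank G t ≡ just α
    at-top agr α≡k t t∈S with rank-range agr t t∈S
    ... | j , e , k≤j , j≤α = trans (agree agr t t∈S) (trans e (cong just (≤-antisym j≤α (subst (_≤ j) (sym α≡k) k≤j))))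

    occupied : ∀ f k S j {c} → count f k S j ≡ suc c → Σ Vertex λ v → S v ≡ true
    occupied f k S j e = let (v , q) = countB-witness _ e in v , ∧-conicalˡ _ _ q

    data Round (S : VSet) : Set where
      final : isClique G S ≡ true → Round S
      peel  : isClique G S ≡ false → hasCorner G S ≡ true → Round S

    round : ∀ {f k S} → Agrees (suc f) k S → (Σ Vertex λ v → S v ≡ true) → Round S
    round {f} {k} {S} agr (v , sv) = by-cases (isClique G S) refl (hasCorner G S) refl
      where
      by-cases : ∀ b → isClique G S ≡ b → ∀ c → hasCorner G S ≡ c → Round S
      by-cases true  cl _     _  = final cl
      by-cases false cl true  hc = peel cl hc
      by-cases false cl false hc = ⊥-elim (cop-win v (trans (agree agr v sv) (rank-stuck f k S v cl hc)))

    -- If the round of rank α is not a clique, all its vertices are strict corners,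
    -- since a survivor would get a rank above α.
    all-corners-at-top : ∀ {f k S} → Agrees (suc f) k S → isClique G S ≡ false → hasCorner G S ≡ true →
      α ≡ k → ∀ v → S v ≡ true → strictCorner G S v ≡ true
    all-corners-at-top {f} {k} {S} agr ncl hc α≡k v sv with survives-or-corner S v sv
    ... | inj₂ c   = c
    ... | inj₁ v∈T with rank-range (agrees-next f k S ncl hc agr) v v∈T
    ...   | j , _ , k<j , j≤α = ⊥-elim (<-irrefl refl (≤-trans k<j (subst (j ≤_) α≡k j≤α)))

    counts-next : ∀ f k S (P : ℕ → Set) c → isClique G S ≡ false → hasCorner G S ≡ true →
      (∀ j → k < j → P j → count (suc f) k S j ≡ c) → ∀ j → suc k ≤ j → P j → count f (suc k) (step G S) j ≡ c
    counts-next f k S P c ncl hc h j k<j pj = trans (sym (count-next f k S j k<j ncl hc)) (h j k<j pj)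

    odd-path : ∀ f d k S → α ≡ k + d → Agrees f k S → count f k S α ≡ 1 →
      (∀ j → k ≤ j → j < α → count f k S j ≡ 2) → Σ (ℕ → Vertex) λ p → IsPath S (suc (d + d)) p
    odd-path zero d k S _ _ c-top _ = ⊥-elim (1+n≢0 (trans (sym c-top) (count-nofuel k S α)))
    odd-path (suc f) zero k S α≡ agr c-top _ with round agr (occupied (suc f) k S α c-top)
    ... | final cl =
      let (a , a∈S , only) = countB-one-inv S (trans (sym (count-clique-here f k S cl)) (subst (λ j → count (suc f) k S j ≡ 1) α≡k c-top))
      in (λ _ → a) , vertex-path a∈S only
      where
      α≡k : α ≡ k
      α≡k = trans α≡ (+-identityʳ k)
    ... | peel ncl hc =
      let (x , cx , only) = countB-one-inv (strictCorner G S) (trans (sym (count-corners f k S ncl hc)) (subst (λ j → count (suc f) k S j ≡ 1) α≡k c-top))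
      in ⊥-elim (not-all-corners S x x (λ u su → inj₁ (only u (all-corners-at-top agr ncl hc α≡k u su))) cx cx)
      where
      α≡k : α ≡ k
      α≡k = trans α≡ (+-identityʳ k)
    odd-path (suc f) (suc d) k S α≡ agr c-top c-low with round agr (occupied (suc f) k S α c-top)
    ... | final cl = ⊥-elim (1+n≢0 (trans (sym c-top) (count-clique-elsewhere f k S α (λ k≡α → <-irrefl k≡α k<α) cl)))
      where
      k<α : k < α
      k<α = subst (k <_) (sym α≡) (m<m+n k (s≤s z≤n))
    ... | peel ncl hc = unpeel (two-corners S (trans (sym (count-corners f k S ncl hc)) (c-low k ≤-refl k<α)))
      where
      k<α : k < α
      k<α = subst (k <_) (sym α≡) (m<m+n k (s≤s z≤n))
      T-path : Σ (ℕ → Vertex) λ p → IsPath (step G S) (suc (d + d)) p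
      T-path = odd-path f d (suc k) (step G S) (trans α≡ (+-suc k d)) (agrees-next f k S ncl hc agr)
        (counts-next f k S (λ j → j ≡ α) 1 ncl hc (λ { j _ refl → c-top }) α k<α refl)
        (counts-next f k S (_< α) 2 ncl hc (λ j k<j → c-low j (≤-trans (n≤1+n k) k<j)))
      unpeel : (Σ Vertex λ x → Σ Vertex λ y → x ≢ y × CornersAmong S x y) →
        Σ (ℕ → Vertex) λ q → IsPath S (suc (suc d + suc d)) q
      unpeel (x , y , x≢y , among) = extend d T-path
        where
        open Unpeel among
        extend : ∀ d → (Σ (ℕ → Vertex) λ p → IsPath T (suc (d + d)) p) →
          Σ (ℕ → Vertex) λ q → IsPath S (suc (suc d + suc d)) q
        extend zero     (p , path) = grow refl (pendants-on-vertex x≢y path) path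
        extend (suc d′) (p , path) =
          let (q , qpath) = grow ℓ≡ (pendants-on-long-path (cast-length ℓ≡ path)) path
          in q , cast-length (sym (peel-length 1 (suc d′))) qpath
          where
          ℓ≡ : suc (suc d′ + suc d′) ≡ suc (suc (suc (d′ + d′)))
          ℓ≡ = peel-length 1 d′

    -- Counts (1, 2, …, 2, 1) for ranks α, …, k are impossible: the next round is a path
    -- on at least three vertices, and a single corner cannot be glued to both its ends.
    no-final-one : ∀ f k S d → α ≡ suc k + suc d → Agrees f k S → count f k S k ≡ 1 → count f k S α ≡ 1 →
      (∀ j → k < j → j < α → count f k S j ≡ 2) → ⊥
    no-final-one zero k S d _ _ c-k _ _ = 1+n≢0 (trans (sym c-k) (count-nofuel k S k))
    no-final-one (suc f) k S d α≡ agr c-k c-top c-mid = by-round (round agr (occupied (suc f) k S k c-k))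
      where
      k<α : k < α
      k<α = subst (k <_) (sym α≡) (s≤s (m≤m+n k (suc d)))
      by-round : Round S → ⊥
      by-round (final cl) = 1+n≢0 (trans (sym c-top) (count-clique-elsewhere f k S α (λ k≡α → <-irrefl k≡α k<α) cl))
      by-round (peel ncl hc) = single-corner (one-corner S (trans (sym (count-corners f k S ncl hc)) c-k))
        where
        T-path : Σ (ℕ → Vertex) λ p → IsPath (step G S) (suc (suc d + suc d)) p
        T-path = odd-path f (suc d) (suc k) (step G S) α≡ (agrees-next f k S ncl hc agr)
          (counts-next f k S (λ j → j ≡ α) 1 ncl hc (λ { j _ refl → c-top }) α k<α refl)
          (counts-next f k S (_< α) 2 ncl hc c-mid)
        single-corner : (Σ Vertex λ x → CornersAmong S x x) → ⊥
        single-corner (x , among) =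
          no-pendants-for-one-corner refl (pendants-on-long-path (cast-length (peel-length 1 d) (proj₂ T-path)))
          where open Unpeel among

    module TypeZero (type0 : Type0 G) (α≡cr : cornerRank G ≡ α) where

      no-full-at-top : ∀ {f k} → α ≡ suc (suc k) → Agrees f (suc (suc k)) (stage G (suc (suc k))) →
        ∀ t → stage G (suc (suc k)) t ≡ true → Full (stage G (suc k)) t → ⊥
      no-full-at-top {f} {k} α≡ agr t t∈T full =
        type0 (subst (2 ≤_) (sym cr≡) (s≤s (s≤s z≤n)) , t , trans (at-top agr α≡ t t∈T) (cong just (sym α≡cr)) , sees)
        where
        cr≡ : cornerRank G ≡ suc (suc k)
        cr≡ = trans α≡cr α≡
        sees : ∀ u → stage G (cornerRank G ∸ 1) u ≡ true → adj G t u ≡ true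
        sees u su = full u (subst (λ r → stage G (r ∸ 1) u ≡ true) cr≡ su)

      even-path : ∀ f d k → α ≡ suc k + d → Agrees f (suc k) (stage G (suc k)) →
        (∀ j → suc k ≤ j → j ≤ α → count f (suc k) (stage G (suc k)) j ≡ 2) →
        Σ (ℕ → Vertex) λ p → IsPath (stage G (suc k)) (suc d + suc d) p
      even-path zero d k α≡ _ c =
        ⊥-elim (1+n≢0 (trans (sym (c (suc k) ≤-refl (subst (suc k ≤_) (sym α≡) (m≤m+n (suc k) d)))) (count-nofuel (suc k) _ (suc k))))
      even-path (suc f) zero k α≡ agr c = by-round (round agr (occupied (suc f) (suc k) S (suc k) c-here))
        where
        S : VSet
        S = stage G (suc k)
        α≡k : α ≡ suc k
        α≡k = trans α≡ (+-identityʳ (suc k))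
        c-here : count (suc f) (suc k) S (suc k) ≡ 2
        c-here = c (suc k) ≤-refl (subst (suc k ≤_) (sym α≡k) ≤-refl)
        by-round : Round S → Σ (ℕ → Vertex) λ p → IsPath S 2 p
        by-round (final cl) =
          let (a , b , a≢b , a∈S , b∈S , only) = countB-two-inv S (trans (sym (count-clique-here f (suc k) S cl)) c-here)
          in edge-path a≢b a∈S b∈S only (clique-sound S cl a b a∈S b∈S)
        by-round (peel ncl hc) =
          let (x , y , _ , cx , cy , only) = countB-two-inv (strictCorner G S) (trans (sym (count-corners f (suc k) S ncl hc)) c-here)
          in ⊥-elim (not-all-corners S x y (λ u su → only u (all-corners-at-top agr ncl hc α≡k u su)) cx cy)
      even-path (suc f) (suc d) k α≡ agr c = by-round (round agr (occupied (suc f) (suc k) S (suc k) c-here))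
        where
        S : VSet
        S = stage G (suc k)
        k<α : suc k < α
        k<α = subst (suc k <_) (sym α≡) (m<m+n (suc k) (s≤s z≤n))
        c-here : count (suc f) (suc k) S (suc k) ≡ 2
        c-here = c (suc k) ≤-refl (≤-trans (n≤1+n _) k<α)
        by-round : Round S → Σ (ℕ → Vertex) λ p → IsPath S (suc (suc d) + suc (suc d)) p
        by-round (final cl) =
          ⊥-elim (1+n≢0 (trans (sym (c α (≤-trans (n≤1+n _) k<α) ≤-refl)) (count-clique-elsewhere f (suc k) S α (λ k≡α → <-irrefl k≡α k<α) cl)))
        by-round (peel ncl hc) = unpeel (two-corners S (trans (sym (count-corners f (suc k) S ncl hc)) c-here))
          where
          agr′ : Agrees f (suc (suc k)) (step G S)
          agr′ = agrees-next f (suc k) S ncl hc agr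
          T-path : Σ (ℕ → Vertex) λ p → IsPath (step G S) (suc d + suc d) p
          T-path = even-path f d (suc k) (trans α≡ (+-suc (suc k) d)) agr′
            (counts-next f (suc k) S (_≤ α) 2 ncl hc (λ j k<j → c j (≤-trans (n≤1+n _) k<j)))
          unpeel : (Σ Vertex λ x → Σ Vertex λ y → x ≢ y × CornersAmong S x y) →
            Σ (ℕ → Vertex) λ q → IsPath S (suc (suc d) + suc (suc d)) q
          unpeel (x , y , _ , among) = extend d (trans α≡ (+-suc (suc k) d)) T-path
            where
            open Unpeel among
            extend : ∀ d → α ≡ suc (suc k) + d → (Σ (ℕ → Vertex) λ p → IsPath T (suc d + suc d) p) →
              Σ (ℕ → Vertex) λ q → IsPath S (suc (suc d) + suc (suc d)) q
            extend zero α≡′ (p , path) =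
              grow refl (pendants-on-edge (no-full-at-top (trans α≡′ (+-identityʳ _)) agr′) path) path
            extend (suc d′) _ (p , path) =
              let (q , qpath) = grow (double-suc (suc d′)) (pendants-on-long-path (cast-length (double-suc (suc d′)) path)) path
              in q , cast-length (sym (double-suc (suc (suc d′)))) qpath

      no-evens-final-one : ∀ f k d → α ≡ suc (suc k) + d → Agrees f (suc k) (stage G (suc k)) →
        count f (suc k) (stage G (suc k)) (suc k) ≡ 1 →
        (∀ j → suc (suc k) ≤ j → j ≤ α → count f (suc k) (stage G (suc k)) j ≡ 2) → ⊥
      no-evens-final-one zero k d _ _ c-k _ = 1+n≢0 (trans (sym c-k) (count-nofuel (suc k) _ (suc k)))
      no-evens-final-one (suc f) k d α≡ agr c-k c-up = by-round (round agr (occupied (suc f) (suc k) S (suc k) c-k))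
        where
        S : VSet
        S = stage G (suc k)
        k<α : suc k < α
        k<α = subst (suc k <_) (sym α≡) (s≤s (s≤s (m≤m+n k d)))
        by-round : Round S → ⊥
        by-round (final cl) =
          1+n≢0 (trans (sym (c-up α k<α ≤-refl)) (count-clique-elsewhere f (suc k) S α (λ k≡α → <-irrefl k≡α k<α) cl))
        by-round (peel ncl hc) = single-corner (one-corner S (trans (sym (count-corners f (suc k) S ncl hc)) c-k))
          where
          agr′ : Agrees f (suc (suc k)) (step G S)
          agr′ = agrees-next f (suc k) S ncl hc agr
          T-path : Σ (ℕ → Vertex) λ p → IsPath (step G S) (suc d + suc d) p
          T-path = even-path f d (suc k) α≡ agr′ (counts-next f (suc k) S (_≤ α) 2 ncl hc c-up)
          single-corner : (Σ Vertex λ x → CornersAmong S x x) → ⊥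
          single-corner (x , among) = impossible d α≡ T-path
            where
            open Unpeel among
            impossible : ∀ d → α ≡ suc (suc k) + d → (Σ (ℕ → Vertex) λ p → IsPath T (suc d + suc d) p) → ⊥
            impossible zero α≡′ (p , path) = no-pendants-for-one-corner refl
              (pendants-on-edge (no-full-at-top (trans α≡′ (+-identityʳ _)) agr′) path)
            impossible (suc d′) _ (p , path) = no-pendants-for-one-corner refl
              (pendants-on-long-path (cast-length (double-suc (suc d′)) path))

  initial-agreement : Agrees (order G) 1 (allV G)
  initial-agreement = agreeing λ _ _ → refl

  countAt : ℕ → ℕ
  countAt = count (order G) 1 (allV G)

  hasRank-count : ∀ k → countB (hasRank G k) ≡ countAt k
  hasRank-count k = countB-cong _ _ pointwise
    where
    pointwise : ∀ v → hasRank G k v ≡ isRank (rank G v) k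
    pointwise v with rank G v
    ... | just m  = refl
    ... | nothing = refl

  rankCardVec-at : ∀ a → cornerRank G ≡ a → rankCardVec G ≡ map countAt (map suc (downFrom a))
  rankCardVec-at a refl = map-cong hasRank-count (map suc (downFrom (cornerRank G)))

  length-rankCardVec : length (rankCardVec G) ≡ cornerRank G
  length-rankCardVec = trans (length-map _ (map suc (downFrom (cornerRank G))))
                             (trans (length-map suc (downFrom (cornerRank G))) (length-downFrom (cornerRank G)))

  rankℕ-just : ∀ v j → rank G v ≡ just j → rankℕ G v ≡ j
  rankℕ-just v j e with rank G v
  rankℕ-just v j refl | just .j = refl

  rank-bound : ∀ v j → rank G v ≡ just j → j ≤ cornerRank G
  rank-bound v j e = subst (_≤ cornerRank G) (rankℕ-just v j e) (maxF-upper (rankℕ G) v)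

  cornerRank-is : ∀ α {c} → (∀ v j → rank G v ≡ just j → j ≤ α) → countAt α ≡ suc c → cornerRank G ≡ α
  cornerRank-is α bounded e with countB-witness _ e
  ... | v , has-α = ≤-antisym (maxF-least (rankℕ G) α below) (subst (_≤ cornerRank G) (rankℕ-just v α rank-v) (maxF-upper (rankℕ G) v))
    where
    rank-v : rank G v ≡ just α
    rank-v with rank G v
    ... | just m = cong just (≡ᵇ-sound m α has-α)
    below : ∀ v → rankℕ G v ≤ α
    below v with rank G v in e
    ... | just j  = bounded v j e
    ... | nothing = z≤n

  path-iso : ∀ {L p} m (h : 1 ≤ m) → L ≡ m → IsPath (allV G) L p → G ≅ P m h
  path-iso {L} {p} .L h refl path = record { to = to ; from = from ; from-to = from-to ; to-from = to-from ; adj-pres = adj-pres }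
    where
    open IsPath path
    index : Vertex → ℕ
    index v = proj₁ (cover v refl)
    index< : ∀ v → index v < L
    index< v = proj₁ (proj₂ (cover v refl))
    at-index : ∀ v → p (index v) ≡ v
    at-index v = proj₂ (proj₂ (cover v refl))
    to : Vertex → Fin L
    to v = fromℕ< (index< v)
    from : Fin L → Vertex
    from w = p (toℕ w)
    from-to : ∀ v → from (to v) ≡ v
    from-to v = trans (cong p (toℕ-fromℕ< (index< v))) (at-index v)
    to-from : ∀ w → to (from w) ≡ w
    to-from w = toℕ-injective (trans (toℕ-fromℕ< (index< (p (toℕ w))))
                                      (inj _ _ (index< (p (toℕ w))) (toℕ<n w) (at-index (p (toℕ w)))))
    adj-pres : ∀ u v → adj (P L h) (to u) (to v) ≡ adj G u v
    adj-pres u v = trans (cong₂ padj (toℕ-fromℕ< (index< u)) (toℕ-fromℕ< (index< v)))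
                         (trans (sym (pa (index u) (index v) (index< u) (index< v))) (cong₂ (adj G) (at-index u) (at-index v)))

  path-graph-realizes : ∀ d r′ {p} → r′ ≤ 1 → suc r′ + (d + d) ≡ order G → IsPath (allV G) (suc r′ + (d + d)) p →
    Realizes G (suc r′ ∷ replicate d 2) × cornerRank G ≡ suc d
  path-graph-realizes d r′ {p} r′≤1 L≡n path =
    (cop-win , trans (rankCardVec-at (suc d) corner-rank) (cong₂ _∷_ top (entries-replicate d 2 countAt lower))) , corner-rank
    where
    d<n : d < order G
    d<n = subst (d <_) L≡n (s≤s (≤-trans (m≤m+n d d) (m≤n+m (d + d) r′)))
    ranks : RankProfile d (suc r′) (order G) 1 (allV G)
    ranks = path-ranks d r′ (order G) 1 (allV G) p r′≤1 d<n path
    top : countAt (suc d) ≡ suc r′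
    top = proj₁ (proj₂ ranks)
    lower : ∀ j → 1 ≤ j → j ≤ d → countAt j ≡ 2
    lower (suc j) _ j≤d = proj₂ (proj₂ ranks) j j≤d
    cop-win : CopWin G
    cop-win v e with proj₁ ranks v refl
    ... | j , finite , _ = just≢nothing (trans (sym finite) e)
      where
      just≢nothing : ∀ {j : ℕ} → just j ≢ nothing
      just≢nothing ()
    bounded : ∀ v j → rank G v ≡ just j → j ≤ suc d
    bounded v j e with proj₁ ranks v refl
    ... | j′ , e′ , j′≤ with trans (sym e) e′
    ...   | refl = j′≤
    corner-rank : cornerRank G ≡ suc d
    corner-rank = cornerRank-is (suc d) bounded top

  record Reading (α : ℕ) (xs : List ℕ) : Set where
    field
      corner-rank : cornerRank G ≡ α
      bounded     : ∀ v j → rank G v ≡ just j → j ≤ α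
      counts      : map countAt (map suc (downFrom α)) ≡ xs

  read-vector : ∀ α xs → length xs ≡ α → rankCardVec G ≡ xs → Reading α xs
  read-vector α xs len vec = record
    { corner-rank = cr
    ; bounded = λ v j e → subst (j ≤_) cr (rank-bound v j e)
    ; counts = trans (sym (rankCardVec-at α cr)) vec }
    where
    cr : cornerRank G ≡ α
    cr = trans (sym length-rankCardVec) (trans (cong length vec) len)

clampFin : ∀ m → ℕ → Fin (suc m)
clampFin zero    _       = zero
clampFin (suc m) zero    = zero
clampFin (suc m) (suc i) = suc (clampFin m i)

toℕ-clampFin : ∀ m i → i ≤ m → toℕ (clampFin m i) ≡ i
toℕ-clampFin zero    zero    _       = refl
toℕ-clampFin (suc m) zero    _       = refl
toℕ-clampFin (suc m) (suc i) (s≤s p) = cong suc (toℕ-clampFin m i p)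

clampFin-toℕ : ∀ m (w : Fin (suc m)) → clampFin m (toℕ w) ≡ w
clampFin-toℕ zero    zero    = refl
clampFin-toℕ (suc m) zero    = refl
clampFin-toℕ (suc m) (suc w) = cong suc (clampFin-toℕ m w)

PathEnumeration : ∀ m (h : 1 ≤ m) → Set
PathEnumeration m h = Σ (ℕ → Fin m) λ r → OnGraph.IsPath (P m h) (allV (P m h)) m r × (∀ i → i < m → toℕ (r i) ≡ i)

path-enumeration : ∀ m (h : 1 ≤ m) → PathEnumeration m h
path-enumeration (suc m) (s≤s z≤n) = clampFin m ,
  OnGraph.mkPath (λ _ _ → refl) (λ u _ → toℕ u , toℕ<n u , clampFin-toℕ m u)
    (λ i j i< j< e → trans (sym (toℕ-clampFin m i (≤-pred i<))) (trans (cong toℕ e) (toℕ-clampFin m j (≤-pred j<))))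
    (λ i j i< j< → cong₂ padj (toℕ-clampFin m i (≤-pred i<)) (toℕ-clampFin m j (≤-pred j<))) ,
  λ i i< → toℕ-clampFin m i (≤-pred i<)

odd-length : ∀ d → suc (d + d) ≡ 2 * suc d ∸ 1
odd-length d = trans (cong (λ e → suc (d + e)) (sym (+-identityʳ d))) (sym (+-suc d (d + 0)))

even-length : ∀ d → suc d + suc d ≡ 2 * suc d
even-length d = cong (suc d +_) (sym (+-identityʳ (suc d)))

even-length-4 : ∀ a → 4 + (a + a) ≡ 2 * suc (suc a)
even-length-4 a = trans (sym (trans (double-suc (suc a)) (cong (λ (e : ℕ) → suc (suc e)) (double-suc a)))) (even-length (suc a))

odd-path-realizes : ∀ α (h : 2 ≤ α) → Realizes (P (2 * α ∸ 1) (ne-odd h)) (1 ∷ replicate (α ∸ 1) 2)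
odd-path-realizes (suc zero) (s≤s ())
odd-path-realizes (suc (suc a)) h =
  proj₁ (OnGraph.path-graph-realizes (P _ (ne-odd h)) (suc a) 0 z≤n (odd-length (suc a))
          (OnGraph.cast-length (P _ (ne-odd h)) (sym (odd-length (suc a))) (proj₁ (proj₂ (path-enumeration _ (ne-odd h))))))

odd-path-unique : ∀ α (h : 2 ≤ α) G → Realizes G (1 ∷ replicate (α ∸ 1) 2) → G ≅ P (2 * α ∸ 1) (ne-odd h)
odd-path-unique (suc zero) (s≤s ())
odd-path-unique (suc (suc a)) h G (cop-win , vec) =
  path-iso _ (ne-odd h) (odd-length (suc a)) (proj₂ (odd-path (order G) (suc a) 1 (allV G) refl initial-agreement top lower))
  where
  open OnGraph G
  open Reading (read-vector (suc (suc a)) _ (cong suc (length-replicate (suc a))) vec)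
  open Reconstruction cop-win (suc (suc a)) bounded
  top : countAt (suc (suc a)) ≡ 1
  top = proj₁ (∷-injective counts)
  lower : ∀ j → 1 ≤ j → j < suc (suc a) → countAt j ≡ 2
  lower j 1≤j j< = replicate-entries (suc a) 2 countAt (proj₂ (∷-injective counts)) j 1≤j (≤-pred j<)

no-realization-1-2s-1 : ∀ k → 1 ≤ k → ¬ Realizable (1 ∷ replicate k 2 ++ 1 ∷ [])
no-realization-1-2s-1 (suc d) _ (G , cop-win , vec) =
  no-final-one (order G) 1 (allV G) d refl initial-agreement (proj₁ bottom) top middle
  where
  open OnGraph G
  open Reading (read-vector (suc (suc (suc d))) _ (cong suc (length-snoc (suc d) 2 1)) vec)
  open Reconstruction cop-win (suc (suc (suc d))) bounded
  top : countAt (suc (suc (suc d))) ≡ 1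
  top = proj₁ (∷-injective counts)
  bottom : countAt 1 ≡ 1 × (∀ j → 2 ≤ j → j ≤ suc (suc d) → countAt j ≡ 2)
  bottom = snoc-entries (suc d) 2 1 countAt (proj₂ (∷-injective counts))
  middle : ∀ j → 1 < j → j < suc (suc (suc d)) → countAt j ≡ 2
  middle j 1<j j< = proj₂ bottom j 1<j (≤-pred j<)

-- In P_{2α} the round of rank α - 1 is the middle path on four vertices, and no vertex
-- of P_{2α} is adjacent to both of its ends: P_{2α} is of type 0.
even-path-type0 : ∀ d (h : 1 ≤ 2 * suc d) → cornerRank (P (2 * suc d) h) ≡ suc d → Type0 (P (2 * suc d) h)
even-path-type0 zero    h cr (two , _) = <-irrefl refl (subst (2 ≤_) cr two)
even-path-type0 (suc a) h cr (_ , v , _ , sees) = <-irrefl refl (≤-trans three-apart (s≤s (subst (toℕ v ≤_) (cong suc (+-identityʳ a)) (proj₁ near-0))))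
  where
  H : Graph
  H = P (2 * suc (suc a)) h
  open OnGraph H
  enum : PathEnumeration (2 * suc (suc a)) h
  enum = path-enumeration (2 * suc (suc a)) h
  middle : Σ (ℕ → Vertex) λ q → IsPath (stage H (suc a)) 4 q × (∀ i → q i ≡ proj₁ enum (a + i))
  middle = stage-path (proj₁ (proj₂ enum)) a 4 (even-length-4 a) (s≤s z≤n)
  q : ℕ → Vertex
  q = proj₁ middle
  index : ∀ i → i < 4 → toℕ (q i) ≡ a + i
  index i i< = trans (cong toℕ (proj₂ (proj₂ middle) i))
    (proj₂ (proj₂ enum) (a + i)
      (≤-trans (subst (_≤ a + 4) (+-suc a i) (+-monoʳ-≤ a i<)) (subst (a + 4 ≤_) (even-length-4 a)
        (subst (_≤ 4 + (a + a)) (+-comm 4 a) (+-monoʳ-≤ 4 (m≤m+n a a))))))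
  near : ∀ i → i < 4 → toℕ v ≤ suc (a + i) × a + i ≤ suc (toℕ v)
  near i i< = subst (λ t → toℕ v ≤ suc t × t ≤ suc (toℕ v)) (index i i<)
    (padj-sound (toℕ v) (toℕ (q i)) (sees (q i) (subst (λ c → stage H (c ∸ 1) (q i) ≡ true) (sym cr) (OnGraph.IsPath.inS (proj₁ (proj₂ middle)) i i<))))
  near-0 : toℕ v ≤ suc (a + 0) × a + 0 ≤ suc (toℕ v)
  near-0 = near 0 (s≤s z≤n)
  three-apart : suc (suc (suc a)) ≤ suc (toℕ v)
  three-apart = subst (_≤ suc (toℕ v)) (+-comm a 3) (proj₂ (near 3 (s≤s (s≤s (s≤s (s≤s z≤n))))))

even-path-realizes : ∀ α (h : 1 ≤ α) → Realizes0 (P (2 * α) (ne-even h)) (replicate α 2)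
even-path-realizes (suc d) h = proj₁ facts , even-path-type0 d (ne-even h) (proj₂ facts)
  where
  facts : Realizes (P (2 * suc d) (ne-even h)) (2 ∷ replicate d 2) × cornerRank (P (2 * suc d) (ne-even h)) ≡ suc d
  facts = OnGraph.path-graph-realizes (P _ (ne-even h)) d 1 (s≤s z≤n) (trans (sym (double-suc d)) (even-length d))
            (OnGraph.cast-length (P _ (ne-even h)) (trans (sym (even-length d)) (double-suc d)) (proj₁ (proj₂ (path-enumeration _ (ne-even h)))))

even-path-unique : ∀ α (h : 1 ≤ α) G → Realizes0 G (replicate α 2) → G ≅ P (2 * α) (ne-even h)
even-path-unique (suc d) h G ((cop-win , vec) , type0) =
  path-iso _ (ne-even h) (even-length d) (proj₂ (even-path (order G) d 0 refl initial-agreement twos))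
  where
  open OnGraph G
  open Reading (read-vector (suc d) _ (length-replicate (suc d)) vec)
  open Reconstruction cop-win (suc d) bounded
  open TypeZero type0 corner-rank
  twos : ∀ j → 1 ≤ j → j ≤ suc d → countAt j ≡ 2
  twos = replicate-entries (suc d) 2 countAt counts

no-0-realization-2s-1 : ∀ k → 1 ≤ k → ¬ Realizable0 (replicate k 2 ++ 1 ∷ [])
no-0-realization-2s-1 (suc d) _ (G , (cop-win , vec) , type0) =
  no-evens-final-one (order G) 0 d refl initial-agreement (proj₁ bottom) (proj₂ bottom)
  where
  open OnGraph G
  open Reading (read-vector (suc (suc d)) _ (length-snoc (suc d) 2 1) vec)
  open Reconstruction cop-win (suc (suc d)) bounded
  open TypeZero type0 corner-rank
  bottom : countAt 1 ≡ 1 × (∀ j → 2 ≤ j → j ≤ suc (suc d) → countAt j ≡ 2)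
  bottom = snoc-entries (suc d) 2 1 countAt counts

theorem3p22 :
    (∀ (α : ℕ) (h : 2 ≤ α) →
        Realizes (P (2 * α ∸ 1) (ne-odd h)) (1 ∷ replicate (α ∸ 1) 2)
          × (∀ G → Realizes G (1 ∷ replicate (α ∸ 1) 2) → G ≅ P (2 * α ∸ 1) (ne-odd h)))
    × (∀ (k : ℕ) → 1 ≤ k → ¬ Realizable (1 ∷ replicate k 2 ++ 1 ∷ []))
    × (∀ (α : ℕ) (h : 1 ≤ α) →
        Realizes0 (P (2 * α) (ne-even h)) (replicate α 2)
          × (∀ G → Realizes0 G (replicate α 2) → G ≅ P (2 * α) (ne-even h)))
    × (∀ (k : ℕ) → 1 ≤ k → ¬ Realizable0 (replicate k 2 ++ 1 ∷ []))
theorem3p22 =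
    (λ α h → odd-path-realizes α h , odd-path-unique α h)
  , no-realization-1-2s-1
  , (λ α h → even-path-realizes α h , even-path-unique α h)
  , no-0-realization-2s-1
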